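{- Let $P$ be a path with $n$ vertices, all of weight $1$, let $\kappa$ be a nonnegative integer and $t$ a positive integer. Then: (1) $P$ admits $\kappa=0$ players with boundary $t$ if and only if $n\le t$; (2) $P$ admits $\kappa=1$ player with boundary $t$ if and only if $t\le n\le 2t+1$; (3) $P$ admits $\kappa=2$ players with boundary $t$ if and only if $2t\le n\le 2t+2$; (4) $P$ admits $\kappa=3$ players with boundary $t$ if and only if $t=1$ and $n\in\{3,4,5\}$; (5) for every integer $\kappa\ge 4$, $P$ admits $\kappa$ players with boundary $t$ if and only if $(\kappa+1)t-1\le n\le(2\kappa-4)t+\kappa$ when $\kappa$ is odd, and $\kappa t\le n\le(2\kappa-4)t+\kappa$ when $\kappa$ is even.
   Context: Competitive diffusion game $(\kappa,G,w)$: $G=(V,E)$ undirected, $w:V\to\mathbb{Z}$ (here $w\equiv1$), players $p_1,\dots,p_\kappa$. A strategy profile is $\vec{s}=(s^{(1)},\dots,s^{(\kappa)})\in V^\kappa$. At time $1$, each player $p_i$ chooses $s^{(i)}$; if no other player chooses $s^{(i)}$, then $p_i$ dominates it, otherwise $s^{(i)}$ becomes neutral (never dominated). At each time $t\ge 2$, a vertex $v$ that is neither neutral nor dominated by time $t-1$ becomes dominated by $p_i$ if $v$ has a neighbor dominated by $p_i$ and no neighbor dominated by another player; if $v$ has neighbors dominated by two or more distinct players, $v$ becomes neutral. The game ends when no further vertex can be dominated. $U_i(\vec{s})$ is the sum of the weights of the vertices dominated by $p_i$ at the end. $(\vec{s}_{ -i},v')$ is $\vec{s}$ with $s^{(i)}$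 replaced by $v'$. A pure Nash equilibrium is a profile $\vec{s}$ with $U_i(\vec{s}_{ -i},v')\le U_i(\vec{s})$ for all $i$ and all $v'\in V$. For a path $P$: for a profile $\vec{s}$ of $(\kappa,P,w)$, $\mu_P(\vec{s})=\min_{i\in[\kappa]}U_i(\vec{s})$, and for $\kappa=0$ the unique (empty) profile is considered a Nash equilibrium with $\mu_P=+\infty$; $\nu_P(\vec{s})=\max_{v\in V(P)}U_{\kappa+1}(\vec{s}+v)$, where $\vec{s}+v$ is the profile of $(\kappa+1,P,w)$ in which the first $\kappa$ players play as in $\vec{s}$ and an extra $(\kappa+1)$-th player chooses $v$. $P$ admits $\kappa$ players with boundary $t$ if there is a profile $\vec{s}$ that is a Nash equilibrium of $(\kappa,P,w)$ with $\nu_P(\vec{s})\le t\le\mu_P(\vec{s})$. -}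

module Defs where

open import Data.Nat using (ℕ; zero; suc; _+_; _*_; _∸_; _≤_; _⊔_; _⊓_)
open import Data.Fin using (Fin; zero; suc; toℕ; fromℕ; _≟_)
open import Data.Bool using (Bool; true; false; if_then_else_; _∨_)
open import Data.List using (List; []; _∷_; concatMap; length; filter)
open import Data.List.Base using (allFin)
open import Data.Product using (Σ; _×_)
open import Relation.Nullary using (does)
open import Relation.Binary.PropositionalEquality using (_≡_)
open import Data.Nat using (_≡ᵇ_)
open import Function using (_∘_)

-- A graph on vertex set Fin n, given by a (symmetric) Boolean adjacency.
-- All vertex weights are 1, so the utility is the number of vertices.

Graph : ℕ → Set
Graph n = Fin n → Fin n → Bool

data Status (κ : ℕ) : Set where
  free    : Status κ
  neutral : Status κ
  dom     : Fin κ → Status κ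

-- Given the list of players "claiming" a vertex (with repetitions):
-- nobody -> stays free; exactly one distinct player -> dominated by it;
-- two or more distinct players -> neutral.
allB : ∀ {A : Set} → (A → Bool) → List A → Bool
allB p [] = true
allB p (x ∷ xs) = if p x then allB p xs else false

classify : ∀ {κ} → List (Fin κ) → Status κ
classify [] = free
classify (i ∷ is) = if allB (λ j → does (i ≟ j)) is then dom i else neutral

Profile : ℕ → ℕ → Set
Profile κ n = Fin κ → Fin n

initial : ∀ {κ n} → Profile κ n → Fin n → Status κ
initial {κ} s v = classify (filter (λ i → s i ≟ v) (allFin κ))

domBy : ∀ {κ} → Status κ → List (Fin κ)
domBy (dom i) = i ∷ []
domBy _       = []

step : ∀ {κ n} → Graph n → (Fin n → Status κ) → Fin n → Status κ
step {κ} {n} G st v with st v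
... | free = classify (concatMap (λ u → if G u v then domBy (st u) else []) (allFin n))
... | other = other

iter : ∀ {A : Set} → ℕ → (A → A) → A → A
iter zero    f x = x
iter (suc k) f x = f (iter k f x)

-- Final state: after n steps no further vertex can change
-- (each non-stationary step fixes at least one free vertex).
final : ∀ {κ n} → Graph n → Profile κ n → Fin n → Status κ
final {κ} {n} G s = iter n (step G) (initial s)

isDom : ∀ {κ} → Fin κ → Status κ → Bool
isDom i (dom j) = does (i ≟ j)
isDom i _       = false

U : ∀ {κ n} → Graph n → Profile κ n → Fin κ → ℕ
U {κ} {n} G s i = length (filter (λ v → Data.Bool._≟_ (isDom i (final G s v)) true) (allFin n))

update : ∀ {κ n} → Profile κ n → Fin κ → Fin n → Profile κ n
update s i v' j = if does (i ≟ j) then v' else s j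

NashEq : ∀ {κ n} → Graph n → Profile κ n → Set
NashEq {κ} {n} G s = (i : Fin κ) (v' : Fin n) → U G (update s i v') i ≤ U G s i

-- s + v : extra player κ+1 (index fromℕ κ, the last one) chooses v.
extend : ∀ {κ n} → Profile κ n → Fin n → Profile (suc κ) n
extend {zero}  s v zero    = v
extend {suc κ} s v zero    = s zero
extend {suc κ} s v (suc i) = extend (s ∘ suc) v i

pathGraph : (n : ℕ) → Graph n
pathGraph n u v = (suc (toℕ u) ≡ᵇ toℕ v) ∨ (suc (toℕ v) ≡ᵇ toℕ u)

-- ℕ extended with +∞ (for μ of the empty profile).
data ℕ∞ : Set where
  fin : ℕ → ℕ∞
  ∞   : ℕ∞

_⊓∞_ : ℕ∞ → ℕ∞ → ℕ∞
fin a ⊓∞ fin b = fin (a ⊓ b)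
fin a ⊓∞ ∞     = fin a
∞     ⊓∞ y     = y

data _≤∞_ : ℕ∞ → ℕ∞ → Set where
  fin≤fin : ∀ {a b} → a ≤ b → fin a ≤∞ fin b
  ≤∞∞     : ∀ {x} → x ≤∞ ∞

minFin : ∀ {κ} → (Fin κ → ℕ∞) → ℕ∞
minFin {zero}  f = ∞
minFin {suc κ} f = f zero ⊓∞ minFin (f ∘ suc)

maxFin : ∀ {m} → (Fin m → ℕ) → ℕ
maxFin {zero}  f = 0
maxFin {suc m} f = f zero ⊔ maxFin (f ∘ suc)

μ : ∀ {κ n} → Profile κ n → ℕ∞
μ {κ} {n} s = minFin (λ i → fin (U (pathGraph n) s i))

ν : ∀ {κ n} → Profile κ n → ℕ
ν {κ} {n} s = maxFin (λ v → U (pathGraph n) (extend s v) (fromℕ κ))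

Admits : ℕ → ℕ → ℕ → Set
Admits n κ t = Σ (Profile κ n) λ s →
  NashEq (pathGraph n) s × (fin (ν s) ≤∞ fin t) × (fin t ≤∞ μ s)

-- On a path the whole game is decided at time 1. Every free gap between two
-- claimed vertices is filled from both ends, the two players meeting in the middle
-- (the middle vertex of an odd gap becomes neutral), and a gap at an end of the path
-- goes entirely to its only neighbour. Players sharing a vertex get nothing, so for
-- t ≥ 1 the players sit on distinct vertices, and a profile is described by the word
-- of seeds and free vertices, that is by the lengths r₀, …, r_κ of its κ + 1 gaps.
-- The payoffs of the players, of an entrant and of a deviating player are simple
-- functions of these lengths, and the conditions ν ≤ t ≤ μ and Nash become local
-- inequalities between neighbouring gaps. Solving them for two or more players: a
-- seed next to an end gap must have an empty gap on its other side (otherwise it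
-- gains by stepping into the merged gap), so the end gaps have length t − 1 or t;
-- inner gaps have length at most 2t, and the halves of two neighbouring inner gaps
-- add up to at least t − 1. The extremal gap sequences give the bounds of the
-- theorem, and every n in between is reached by growing one gap at a time.

module Submission where

open import Defs
open import Data.Nat using (ℕ; suc; _+_; _*_; _∸_; _≤_; _%_)
open import Data.Product using (_×_)
open import Data.Sum using (_⊎_)
open import Function.Bundles using (_⇔_)
open import Relation.Binary.PropositionalEquality using (_≡_)

open import Data.Nat using (zero; _<_; z≤n; s≤s; _⊔_; ⌊_/2⌋; ⌈_/2⌉; _≤?_)
open import Data.Nat.Properties hiding (_≟_)
open import Data.Nat.DivMod using ([m+n]%n≡m%n)
open import Data.Nat.Solver using (module +-*-Solver)
open import Data.Fin using (Fin; zero; suc; toℕ; _≟_; fromℕ; fromℕ<; inject₁)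
open import Data.Fin.Properties using (toℕ-injective; toℕ-fromℕ<; fromℕ≢inject₁; any?)
open import Data.List using (List; []; _∷_; _++_; null; length; filter; concat; replicate; tabulate; allFin; map; lookup)
open import Data.List.Properties using (∷-injective; tabulate-cong; length-tabulate; ++-assoc; ++-identityʳ; map-++; length-++; map-tabulate; tabulate-lookup; length-map)
open import Data.List.Relation.Unary.All using (All; []; _∷_; universal) renaming (tail to All-tail; map to All-map)
open import Data.List.Relation.Unary.All.Properties using (tabulate⁺; map⁺; map⁻; ++⁺; ++⁻ˡ; ++⁻ʳ)
open import Data.Nat.ListAction using (sum)
open import Data.Nat.ListAction.Properties using (sum-++)
open import Data.List.Relation.Unary.Any using (here; there)
open import Data.List.Membership.Propositional using (_∈_)
open import Data.List.Membership.Propositional.Properties using (∈-allFin)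
open import Data.Bool using (Bool; true; false; if_then_else_; _∧_)
open import Data.Bool.Properties using (∧-identityʳ; ∧-zeroʳ)
open import Data.Product using (Σ; _,_; proj₁; proj₂; ∃)
open import Data.Sum using (inj₁; inj₂)
open import Data.Empty using (⊥; ⊥-elim)
open import Data.Unit using (⊤; tt)
open import Function using (_∘_)
open import Function.Bundles using (mk⇔)
open import Function.Construct.Composition using (_⇔-∘_)
open import Relation.Nullary using (does; Dec; yes; no; ¬_)
open import Relation.Nullary.Decidable using (dec-true; dec-false)
open import Algebra.Properties.CommutativeMonoid.Sum +-0-commutativeMonoid
  using (∑-distrib-+; sum-cong-≗; sum-replicate-zero) renaming (sum to ∑)
open import Relation.Binary.PropositionalEquality
open +-*-Solver

private variable
  κ n : ℕ
  T : Set

-- The game on a path, computed segment by segment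

stepVertex : Status κ → Status κ → Status κ → Status κ
stepVertex l free r = classify (domBy l ++ domBy r)
stepVertex l neutral r = neutral
stepVertex l (dom i) r = dom i

headOr : List T → T → T
headOr [] r = r
headOr (x ∷ _) r = x

stepSegment : Status κ → List (Status κ) → Status κ → List (Status κ)
stepSegment l [] r = []
stepSegment l (x ∷ xs) r = stepVertex l x (headOr xs r) ∷ stepSegment x xs r

runSegment : ℕ → Status κ → List (Status κ) → Status κ → List (Status κ)
runSegment k l w r = iter k (λ w → stepSegment l w r) w

leftNeighbour : Status κ → (Fin n → Status κ) → Fin n → Status κ
leftNeighbour l st zero = l
leftNeighbour l st (suc v) = leftNeighbour (st zero) (st ∘ suc) v

rightNeighbour : Status κ → (Fin n → Status κ) → Fin n → Status κ
rightNeighbour {n = suc zero} r st zero = r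
rightNeighbour {n = suc (suc n)} r st zero = st (suc zero)
rightNeighbour {n = suc (suc n)} r st (suc v) = rightNeighbour r (st ∘ suc) v

concat-tabulate-[] : ∀ {n} (h : Fin n → List T) → (∀ u → h u ≡ []) → concat (tabulate h) ≡ []
concat-tabulate-[] {n = zero} h e = refl
concat-tabulate-[] {n = suc n} h e rewrite e zero = concat-tabulate-[] (h ∘ suc) (e ∘ suc)

path-neighbours : ∀ {n} (st : Fin n → Status κ) (v : Fin n) →
  concat (tabulate (λ u → if pathGraph n u v then domBy (st u) else [])) ≡
  domBy (leftNeighbour free st v) ++ domBy (rightNeighbour free st v)
path-neighbours {n = suc zero} st zero = refl
path-neighbours {n = suc (suc n)} st zero =
  trans (cong (domBy (st (suc zero)) ++_) (concat-tabulate-[] {n = n} (λ u → if pathGraph (suc (suc n)) (suc (suc u)) zero then domBy (st (suc (suc u))) else []) λ _ → refl)) (++-identityʳ _)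
path-neighbours {n = suc (suc n)} st (suc zero) = cong (domBy (st zero) ++_) (path-neighbours (st ∘ suc) zero)
path-neighbours {n = suc (suc n)} st (suc (suc v)) = path-neighbours (st ∘ suc) (suc v)

step-path : ∀ {n} (st : Fin n → Status κ) (v : Fin n) →
  step (pathGraph n) st v ≡ stepVertex (leftNeighbour free st v) (st v) (rightNeighbour free st v)
step-path {n = n} st v with st v
... | free = cong classify (trans (cong concat (map-tabulate {n = n} (λ u → u) (λ u → if pathGraph n u v then domBy (st u) else []))) (path-neighbours st v))
... | neutral = refl
... | dom i = refl

tabulate-stepVertex : ∀ {n} (l r : Status κ) (st : Fin n → Status κ) →
  tabulate (λ v → stepVertex (leftNeighbour l st v) (st v) (rightNeighbour r st v)) ≡ stepSegment l (tabulate st) r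
tabulate-stepVertex {n = zero} l r st = refl
tabulate-stepVertex {n = suc zero} l r st = refl
tabulate-stepVertex {n = suc (suc n)} l r st = cong (stepVertex l (st zero) (st (suc zero)) ∷_) (tabulate-stepVertex (st zero) r (st ∘ suc))

tabulate-iter-step : ∀ {n} k (st : Fin n → Status κ) →
  tabulate (iter k (step (pathGraph n)) st) ≡ runSegment k free (tabulate st) free
tabulate-iter-step zero st = refl
tabulate-iter-step (suc k) st =
  trans (tabulate-cong (step-path (iter k (step (pathGraph _)) st)))
  (trans (tabulate-stepVertex free free _) (cong (λ w → stepSegment free w free) (tabulate-iter-step k st)))

-- A vertex that no longer changes cuts a segment into two that evolve independently.
Settled : Status κ → Set
Settled {κ} X = ∀ (l r : Status κ) → stepVertex l X r ≡ X

stepSegment-settled : ∀ (l X r : Status κ) → Settled X → (A B : List (Status κ)) →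
  stepSegment l (A ++ X ∷ B) r ≡ stepSegment l A X ++ X ∷ stepSegment X B r
stepSegment-settled l X r fx [] B = cong (_∷ stepSegment X B r) (fx l (headOr B r))
stepSegment-settled l X r fx (a ∷ A) B = cong₂ _∷_ (cong (stepVertex l a) (next A)) (stepSegment-settled a X r fx A B)
  where
  next : ∀ A → headOr (A ++ X ∷ B) r ≡ headOr A X
  next [] = refl
  next (_ ∷ _) = refl

runSegment-settled : ∀ k (l X r : Status κ) → Settled X → (A B : List (Status κ)) →
  runSegment k l (A ++ X ∷ B) r ≡ runSegment k l A X ++ X ∷ runSegment k X B r
runSegment-settled zero l X r fx A B = refl
runSegment-settled (suc k) l X r fx A B =
  trans (cong (λ w → stepSegment l w r) (runSegment-settled k l X r fx A B))
        (stepSegment-settled l X r fx (runSegment k l A X) (runSegment k X B r))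

iter-suc : ∀ k (f : T → T) x → iter (suc k) f x ≡ iter k f (f x)
iter-suc zero f x = refl
iter-suc (suc k) f x = cong f (iter-suc k f x)

runSegment-[] : ∀ k (l r : Status κ) → runSegment k l [] r ≡ []
runSegment-[] zero l r = refl
runSegment-[] (suc k) l r rewrite runSegment-[] k l r = refl

runSegment-settledˡ : ∀ k (l X r : Status κ) → Settled X → (B : List (Status κ)) →
  runSegment k l (X ∷ B) r ≡ X ∷ runSegment k X B r
runSegment-settledˡ k l X r fx B = trans (runSegment-settled k l X r fx [] B) (cong (_++ X ∷ runSegment k X B r) (runSegment-[] k l X))

runSegment-settledʳ : ∀ k (l X r : Status κ) → Settled X → (A : List (Status κ)) →
  runSegment k l (A ++ X ∷ []) r ≡ runSegment k l A X ++ X ∷ []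
runSegment-settledʳ k l X r fx A = trans (runSegment-settled k l X r fx A []) (cong (λ z → runSegment k l A X ++ X ∷ z) (runSegment-[] k X r))

Inert : Status κ → Set
Inert x = domBy x ≡ []

stepSegment-inert : ∀ a (l r : Status κ) → Inert l → Inert r →
  stepSegment l (replicate a free) r ≡ replicate a free
stepSegment-inert zero l r bl br = refl
stepSegment-inert (suc zero) l r bl br rewrite bl | br = refl
stepSegment-inert (suc (suc a)) l r bl br = cong₂ _∷_ (cong (λ z → classify (z ++ [])) bl) (stepSegment-inert (suc a) free r refl br)

runSegment-inert : ∀ k a (l r : Status κ) → Inert l → Inert r →
  runSegment k l (replicate a free) r ≡ replicate a free
runSegment-inert zero a l r bl br = refl
runSegment-inert (suc k) a l r bl br =
  trans (cong (λ w → stepSegment l w r) (runSegment-inert k a l r bl br)) (stepSegment-inert a l r bl br)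

stepSegment-spreadˡ : ∀ a (l : Status κ) j → Inert l →
  stepSegment l (replicate (suc a) free) (dom j) ≡ replicate a free ++ dom j ∷ []
stepSegment-spreadˡ zero l j bl rewrite bl = refl
stepSegment-spreadˡ (suc a) l j bl = cong₂ _∷_ (cong (λ z → classify (z ++ [])) bl) (stepSegment-spreadˡ a free j refl)

-- For i ≢ j the middle vertex of an odd gap is reached by both players at once.
contested : Fin κ → Fin κ → ℕ → List (Status κ)
contested i j zero = []
contested i j (suc zero) = classify (i ∷ j ∷ []) ∷ []
contested i j (suc (suc a)) = dom i ∷ (contested i j a ++ dom j ∷ [])

fillGap : Status κ → ℕ → Status κ → List (Status κ)
fillGap (dom i) a (dom j) = contested i j a
fillGap (dom i) a free = replicate a (dom i)
fillGap (dom i) a neutral = replicate a (dom i)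
fillGap free a (dom j) = replicate a (dom j)
fillGap neutral a (dom j) = replicate a (dom j)
fillGap free a free = replicate a free
fillGap free a neutral = replicate a free
fillGap neutral a free = replicate a free
fillGap neutral a neutral = replicate a free

replicate-snoc : ∀ a (x : Status κ) → replicate a x ++ x ∷ [] ≡ x ∷ replicate a x
replicate-snoc zero x = refl
replicate-snoc (suc a) x = cong (x ∷_) (replicate-snoc a x)

runSegment-suc : ∀ k (l r : Status κ) w → runSegment (suc k) l w r ≡ runSegment k l (stepSegment l w r) r
runSegment-suc k l r w = iter-suc k (λ w → stepSegment l w r) w

runSegment-ownedˡ : ∀ a k i (r : Status κ) → Inert r → a ≤ k →
  runSegment k (dom i) (replicate a free) r ≡ replicate a (dom i)
runSegment-ownedˡ zero k i r br le = runSegment-[] k (dom i) r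
runSegment-ownedˡ (suc a) (suc k) i r br (s≤s le) = begin
    runSegment (suc k) (dom i) (replicate (suc a) free) r
  ≡⟨ runSegment-suc k (dom i) r _ ⟩
    runSegment k (dom i) (stepSegment (dom i) (replicate (suc a) free) r) r
  ≡⟨ cong (λ w → runSegment k (dom i) w r) (e1 a) ⟩
    runSegment k (dom i) (dom i ∷ replicate a free) r
  ≡⟨ runSegment-settledˡ k (dom i) (dom i) r (λ _ _ → refl) (replicate a free) ⟩
    dom i ∷ runSegment k (dom i) (replicate a free) r
  ≡⟨ cong (dom i ∷_) (runSegment-ownedˡ a k i r br le) ⟩
    replicate (suc a) (dom i) ∎
  where
  open ≡-Reasoning
  e1 : ∀ a → stepSegment (dom i) (replicate (suc a) free) r ≡ dom i ∷ replicate a free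
  e1 zero rewrite br = refl
  e1 (suc a') = cong (dom i ∷_) (stepSegment-inert (suc a') free r refl br)

runSegment-ownedʳ : ∀ a k (l : Status κ) j → Inert l → a ≤ k →
  runSegment k l (replicate a free) (dom j) ≡ replicate a (dom j)
runSegment-ownedʳ zero k l j bl le = runSegment-[] k l (dom j)
runSegment-ownedʳ (suc a) (suc k) l j bl (s≤s le) = begin
    runSegment (suc k) l (replicate (suc a) free) (dom j)
  ≡⟨ runSegment-suc k l (dom j) _ ⟩
    runSegment k l (stepSegment l (replicate (suc a) free) (dom j)) (dom j)
  ≡⟨ cong (λ w → runSegment k l w (dom j)) (stepSegment-spreadˡ a l j bl) ⟩
    runSegment k l (replicate a free ++ dom j ∷ []) (dom j)
  ≡⟨ runSegment-settledʳ k l (dom j) (dom j) (λ _ _ → refl) (replicate a free) ⟩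
    runSegment k l (replicate a free) (dom j) ++ dom j ∷ []
  ≡⟨ cong (_++ dom j ∷ []) (runSegment-ownedʳ a k l j bl le) ⟩
    replicate a (dom j) ++ dom j ∷ []
  ≡⟨ replicate-snoc a (dom j) ⟩
    replicate (suc a) (dom j) ∎
  where open ≡-Reasoning

classify-pair-settled : (i j : Fin κ) → Settled (classify (i ∷ j ∷ []))
classify-pair-settled i j l r with does (i ≟ j)
... | true = refl
... | false = refl

runSegment-singleton : ∀ k (l X r : Status κ) → Settled X → runSegment k l (X ∷ []) r ≡ X ∷ []
runSegment-singleton k l X r fx = trans (runSegment-settled k l X r fx [] []) (cong₂ (λ a b → a ++ X ∷ b) (runSegment-[] k l X) (runSegment-[] k X r))

runSegment-contested : ∀ a k (i j : Fin κ) → a ≤ k →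
  runSegment k (dom i) (replicate a free) (dom j) ≡ contested i j a
runSegment-contested zero k i j le = runSegment-[] k (dom i) (dom j)
runSegment-contested (suc zero) (suc k) i j le =
  trans (runSegment-suc k (dom i) (dom j) _) (runSegment-singleton k (dom i) _ (dom j) (classify-pair-settled i j))
runSegment-contested (suc (suc a)) (suc k) i j (s≤s le) = begin
    runSegment (suc k) (dom i) (replicate (suc (suc a)) free) (dom j)
  ≡⟨ runSegment-suc k (dom i) (dom j) _ ⟩
    runSegment k (dom i) (dom i ∷ stepSegment free (replicate (suc a) free) (dom j)) (dom j)
  ≡⟨ cong (λ w → runSegment k (dom i) (dom i ∷ w) (dom j)) (stepSegment-spreadˡ a free j refl) ⟩
    runSegment k (dom i) (dom i ∷ (replicate a free ++ dom j ∷ [])) (dom j)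
  ≡⟨ runSegment-settledˡ k (dom i) (dom i) (dom j) (λ _ _ → refl) _ ⟩
    dom i ∷ runSegment k (dom i) (replicate a free ++ dom j ∷ []) (dom j)
  ≡⟨ cong (dom i ∷_) (runSegment-settledʳ k (dom i) (dom j) (dom j) (λ _ _ → refl) (replicate a free)) ⟩
    dom i ∷ (runSegment k (dom i) (replicate a free) (dom j) ++ dom j ∷ [])
  ≡⟨ cong (λ w → dom i ∷ (w ++ dom j ∷ [])) (runSegment-contested a k i j (≤-trans (n≤1+n a) le)) ⟩
    contested i j (suc (suc a)) ∎
  where open ≡-Reasoning

runSegment-gap : ∀ a k (l r : Status κ) → a ≤ k → runSegment k l (replicate a free) r ≡ fillGap l a r
runSegment-gap a k (dom i) (dom j) le = runSegment-contested a k i j le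
runSegment-gap a k (dom i) free le = runSegment-ownedˡ a k i free refl le
runSegment-gap a k (dom i) neutral le = runSegment-ownedˡ a k i neutral refl le
runSegment-gap a k free (dom j) le = runSegment-ownedʳ a k free j refl le
runSegment-gap a k neutral (dom j) le = runSegment-ownedʳ a k neutral j refl le
runSegment-gap a k free free le = runSegment-inert k a free free refl refl
runSegment-gap a k free neutral le = runSegment-inert k a free neutral refl refl
runSegment-gap a k neutral free le = runSegment-inert k a neutral free refl refl
runSegment-gap a k neutral neutral le = runSegment-inert k a neutral neutral refl refl

fillFrom : Status κ → ℕ → List (Status κ) → Status κ → List (Status κ)
fillFrom l a [] r = fillGap l a r
fillFrom l a (free ∷ w) r = fillFrom l (suc a) w r
fillFrom l a (neutral ∷ w) r = fillGap l a neutral ++ neutral ∷ fillFrom neutral 0 w r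
fillFrom l a (dom i ∷ w) r = fillGap l a (dom i) ++ dom i ∷ fillFrom (dom i) 0 w r

replicate-free-snoc : ∀ a (w : List (Status κ)) → replicate a free ++ free ∷ w ≡ replicate (suc a) free ++ w
replicate-free-snoc a w = trans (sym (++-assoc (replicate a free) (free ∷ []) w))
                          (cong (_++ w) (replicate-snoc a free))

runSegment-fillFrom : ∀ (w : List (Status κ)) l a r k → a + length w ≤ k →
  runSegment k l (replicate a free ++ w) r ≡ fillFrom l a w r
runSegment-fillFrom [] l a r k le = trans (cong (λ w → runSegment k l w r) (++-identityʳ (replicate a free)))
  (runSegment-gap a k l r (subst (_≤ k) (+-identityʳ a) le))
runSegment-fillFrom (free ∷ w) l a r k le = trans (cong (λ w → runSegment k l w r) (replicate-free-snoc a w))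
  (runSegment-fillFrom w l (suc a) r k (subst (_≤ k) (+-suc a (length w)) le))
runSegment-fillFrom (neutral ∷ w) l a r k le = trans (runSegment-settled k l neutral r (λ _ _ → refl) (replicate a free) w)
  (cong₂ (λ x y → x ++ neutral ∷ y) (runSegment-gap a k l neutral (≤-trans (m≤m+n a _) le))
     (runSegment-fillFrom w neutral 0 r k (≤-trans (n≤1+n _) (≤-trans (m≤n+m _ a) le))))
runSegment-fillFrom (dom i ∷ w) l a r k le = trans (runSegment-settled k l (dom i) r (λ _ _ → refl) (replicate a free) w)
  (cong₂ (λ x y → x ++ dom i ∷ y) (runSegment-gap a k l (dom i) (≤-trans (m≤m+n a _) le))
     (runSegment-fillFrom w (dom i) 0 r k (≤-trans (n≤1+n _) (≤-trans (m≤n+m _ a) le))))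

fill : List (Status κ) → List (Status κ)
fill w = fillFrom free 0 w free

layout : Profile κ n → List (Status κ)
layout s = tabulate (initial s)

final-path : ∀ {n} (s : Profile κ n) → tabulate (final (pathGraph n) s) ≡ fill (layout s)
final-path {n = n} s = trans (tabulate-iter-step n (initial s))
  (runSegment-fillFrom (tabulate (initial s)) free 0 free n (≤-reflexive (length-tabulate _)))

indicator : Bool → ℕ
indicator true = 1
indicator false = 0

countDom : Fin κ → List (Status κ) → ℕ
countDom i [] = 0
countDom i (x ∷ xs) = indicator (isDom i x) + countDom i xs

length-filter-isDom : ∀ {n m} (i : Fin κ) (f : Fin m → Status κ) (g : Fin n → Fin m) →
  length (filter (λ v → Data.Bool._≟_ (isDom i (f v)) true) (tabulate g)) ≡ countDom i (tabulate (f ∘ g))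
length-filter-isDom {n = zero} i f g = refl
length-filter-isDom {n = suc n} i f g with isDom i (f (g zero))
... | true = cong suc (length-filter-isDom i f (g ∘ suc))
... | false = length-filter-isDom i f (g ∘ suc)

U-path : ∀ {n} (s : Profile κ n) i → U (pathGraph n) s i ≡ countDom i (fill (layout s))
U-path {n = n} s i = trans (length-filter-isDom i (final (pathGraph n) s) (λ v → v)) (cong (countDom i) (final-path s))

-- Payoffs read off the word of a layout

-- A layout with the players forgotten; payoffs only depend on this word.
data Cell : Set where
  free° neutral° dom° : Cell

shape : Status κ → Cell
shape free = free°
shape neutral = neutral°
shape (dom _) = dom°

leftGap : Cell → ℕ → List Cell → Cell × ℕ
leftGap l a [] = l , a
leftGap l a (free° ∷ w) = leftGap l (suc a) w
leftGap l a (neutral° ∷ w) = leftGap neutral° 0 w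
leftGap l a (dom° ∷ w) = leftGap dom° 0 w

rightGap : List Cell → Cell → ℕ × Cell
rightGap [] r = 0 , r
rightGap (free° ∷ w) r = suc (proj₁ (rightGap w r)) , proj₂ (rightGap w r)
rightGap (neutral° ∷ w) r = 0 , neutral°
rightGap (dom° ∷ w) r = 0 , dom°

share : Cell → ℕ → ℕ
share dom° k = ⌊ k /2⌋
share free° k = k
share neutral° k = k

leftShare : List Cell → ℕ
leftShare A = share (proj₁ (leftGap free° 0 A)) (proj₂ (leftGap free° 0 A))

rightShare : List Cell → ℕ
rightShare B = share (proj₂ (rightGap B free°)) (proj₁ (rightGap B free°))

-- A player seeded between A and B gets its own vertex and its share of the two
-- adjacent gaps: all of a gap ending at the path end, half (rounded down) of a gap
-- ending at another seed.
payoff : List Cell → List Cell → ℕ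
payoff A B = leftShare A + suc (rightShare B)

NotDom : Fin κ → Status κ → Set
NotDom i x = isDom i x ≡ false

does-≟-refl : (i : Fin κ) → does (i ≟ i) ≡ true
does-≟-refl i = dec-true (i ≟ i) refl

does-≟-sym-false : (i j : Fin κ) → does (i ≟ j) ≡ false → does (j ≟ i) ≡ false
does-≟-sym-false i j e with j ≟ i
... | no _ = refl
... | yes refl = trans (sym (does-≟-refl i)) e

countDom-++ : (i : Fin κ) (xs ys : List (Status κ)) → countDom i (xs ++ ys) ≡ countDom i xs + countDom i ys
countDom-++ i [] ys = refl
countDom-++ i (x ∷ xs) ys with isDom i x
... | true = cong suc (countDom-++ i xs ys)
... | false = countDom-++ i xs ys

countDom-replicate-other : (i : Fin κ) → ∀ a x → NotDom i x → countDom i (replicate a x) ≡ 0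
countDom-replicate-other i zero x e = refl
countDom-replicate-other i (suc a) x e rewrite e = countDom-replicate-other i a x e

countDom-replicate-own : (i : Fin κ) → ∀ a → countDom i (replicate a (dom i)) ≡ a
countDom-replicate-own i zero = refl
countDom-replicate-own i (suc a) rewrite does-≟-refl i = cong suc (countDom-replicate-own i a)

countDom-contested-other : (i j k : Fin κ) → ∀ a → NotDom i (dom j) → NotDom i (dom k) →
  countDom i (contested j k a) ≡ 0
countDom-contested-other i j k zero e1 e2 = refl
countDom-contested-other i j k (suc zero) e1 e2 with does (j ≟ k)
... | true rewrite e1 = refl
... | false = refl
countDom-contested-other i j k (suc (suc a)) e1 e2 rewrite e1 =
  trans (countDom-++ i (contested j k a) (dom k ∷ []))
        (cong₂ _+_ (countDom-contested-other i j k a e1 e2) (cong (λ b → indicator b + 0) e2))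

countDom-contestedʳ : (i j : Fin κ) → ∀ a → NotDom i (dom j) → countDom i (contested j i a) ≡ ⌊ a /2⌋
countDom-contestedʳ i j zero e = refl
countDom-contestedʳ i j (suc zero) e rewrite does-≟-sym-false i j e = refl
countDom-contestedʳ i j (suc (suc a)) e rewrite e =
  trans (countDom-++ i (contested j i a) (dom i ∷ []))
  (trans (cong₂ _+_ (countDom-contestedʳ i j a e) (cong (λ b → indicator b + 0) (does-≟-refl i)))
         (+-comm ⌊ a /2⌋ 1))

countDom-contestedˡ : (i j : Fin κ) → ∀ a → NotDom i (dom j) → countDom i (contested i j a) ≡ ⌊ a /2⌋
countDom-contestedˡ i j zero e = refl
countDom-contestedˡ i j (suc zero) e rewrite e = refl
countDom-contestedˡ i j (suc (suc a)) e rewrite does-≟-refl i =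
  cong suc (trans (countDom-++ i (contested i j a) (dom j ∷ []))
  (trans (cong₂ _+_ (countDom-contestedˡ i j a e) (cong (λ b → indicator b + 0) e))
         (+-identityʳ _)))

countDom-fillGap-other : (i : Fin κ) → ∀ l a r → NotDom i l → NotDom i r → countDom i (fillGap l a r) ≡ 0
countDom-fillGap-other i (dom j) a (dom k) e1 e2 = countDom-contested-other i j k a e1 e2
countDom-fillGap-other i (dom j) a free e1 e2 = countDom-replicate-other i a (dom j) e1
countDom-fillGap-other i (dom j) a neutral e1 e2 = countDom-replicate-other i a (dom j) e1
countDom-fillGap-other i free a (dom j) e1 e2 = countDom-replicate-other i a (dom j) e2
countDom-fillGap-other i neutral a (dom j) e1 e2 = countDom-replicate-other i a (dom j) e2
countDom-fillGap-other i free a free e1 e2 = countDom-replicate-other i a free refl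
countDom-fillGap-other i free a neutral e1 e2 = countDom-replicate-other i a free refl
countDom-fillGap-other i neutral a free e1 e2 = countDom-replicate-other i a free refl
countDom-fillGap-other i neutral a neutral e1 e2 = countDom-replicate-other i a free refl

countDom-fillGapʳ : (i : Fin κ) → ∀ l a → NotDom i l → countDom i (fillGap l a (dom i)) ≡ share (shape l) a
countDom-fillGapʳ i free a e = countDom-replicate-own i a
countDom-fillGapʳ i neutral a e = countDom-replicate-own i a
countDom-fillGapʳ i (dom j) a e = countDom-contestedʳ i j a e

countDom-fillGapˡ : (i : Fin κ) → ∀ a r → NotDom i r → countDom i (fillGap (dom i) a r) ≡ share (shape r) a
countDom-fillGapˡ i a free e = countDom-replicate-own i a
countDom-fillGapˡ i a neutral e = countDom-replicate-own i a
countDom-fillGapˡ i a (dom j) e = countDom-contestedˡ i j a e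

countDom-fillFrom-absent : (i : Fin κ) (w : List (Status κ)) → ∀ l a r → All (NotDom i) w → NotDom i l →
  NotDom i r →
  countDom i (fillFrom l a w r) ≡ 0
countDom-fillFrom-absent i [] l a r nw el er = countDom-fillGap-other i l a r el er
countDom-fillFrom-absent i (free ∷ w) l a r (_ ∷ nw) el er = countDom-fillFrom-absent i w l (suc a) r nw el er
countDom-fillFrom-absent i (neutral ∷ w) l a r (_ ∷ nw) el er =
  trans (countDom-++ i (fillGap l a neutral) _)
  (cong₂ _+_ (countDom-fillGap-other i l a neutral el refl) (countDom-fillFrom-absent i w neutral 0 r nw refl er))
countDom-fillFrom-absent i (dom j ∷ w) l a r (ej ∷ nw) el er rewrite countDom-++ i (fillGap l a (dom j)) (dom j ∷ fillFrom (dom j) 0 w r)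
  | countDom-fillGap-other i l a (dom j) el ej | ej = countDom-fillFrom-absent i w (dom j) 0 r nw ej er

countDom-fillFrom-own : (i : Fin κ) (B : List (Status κ)) → ∀ m r → All (NotDom i) B → NotDom i r →
  countDom i (fillFrom (dom i) m B r) ≡
  share (proj₂ (rightGap (map shape B) (shape r))) (m + proj₁ (rightGap (map shape B) (shape r)))
countDom-fillFrom-own i [] m r nb er = trans (countDom-fillGapˡ i m r er) (cong (share (shape r)) (sym (+-identityʳ m)))
countDom-fillFrom-own i (free ∷ B) m r (_ ∷ nb) er =
  trans (countDom-fillFrom-own i B (suc m) r nb er) (cong (share (proj₂ (rightGap (map shape B) (shape r))))
    (sym (+-suc m _)))
countDom-fillFrom-own i (neutral ∷ B) m r (_ ∷ nb) er =
  trans (countDom-++ i (fillGap (dom i) m neutral) _)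
  (trans (cong₂ _+_ (countDom-fillGapˡ i m neutral refl) (countDom-fillFrom-absent i B neutral 0 r nb refl er))
    (trans (+-identityʳ _) (cong (share neutral°) (sym (+-identityʳ m)))))
countDom-fillFrom-own i (dom j ∷ B) m r (ej ∷ nb) er rewrite countDom-++ i (fillGap (dom i) m (dom j)) (dom j ∷ fillFrom (dom j) 0 B r)
  | ej | countDom-fillGapˡ i m (dom j) ej | countDom-fillFrom-absent i B (dom j) 0 r nb ej er
  = trans (+-identityʳ _) (cong (share dom°) (sym (+-identityʳ m)))

countDom-fillFrom-seed : (i : Fin κ) (A B : List (Status κ)) → ∀ l a r → All (NotDom i) A →
  All (NotDom i) B → NotDom i l → NotDom i r →
  countDom i (fillFrom l a (A ++ dom i ∷ B) r) ≡
  share (proj₁ (leftGap (shape l) a (map shape A))) (proj₂ (leftGap (shape l) a (map shape A)))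
  + suc (share (proj₂ (rightGap (map shape B) (shape r))) (proj₁ (rightGap (map shape B) (shape r))))
countDom-fillFrom-seed i [] B l a r na nb el er rewrite countDom-++ i (fillGap l a (dom i)) (dom i ∷ fillFrom (dom i) 0 B r)
  | does-≟-refl i | countDom-fillGapʳ i l a el | countDom-fillFrom-own i B 0 r nb er = refl
countDom-fillFrom-seed i (free ∷ A) B l a r (_ ∷ na) nb el er = countDom-fillFrom-seed i A B l (suc a) r na nb el er
countDom-fillFrom-seed i (neutral ∷ A) B l a r (_ ∷ na) nb el er rewrite countDom-++ i (fillGap l a neutral) (neutral ∷ fillFrom neutral 0 (A ++ dom i ∷ B) r)
  | countDom-fillGap-other i l a neutral el refl = countDom-fillFrom-seed i A B neutral 0 r na nb refl er
countDom-fillFrom-seed i (dom j ∷ A) B l a r (ej ∷ na) nb el er rewrite countDom-++ i (fillGap l a (dom j)) (dom j ∷ fillFrom (dom j) 0 (A ++ dom i ∷ B) r)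
  | countDom-fillGap-other i l a (dom j) el ej | ej = countDom-fillFrom-seed i A B (dom j) 0 r na nb ej er

countDom-fill-seed : (i : Fin κ) (A B : List (Status κ)) → All (NotDom i) A → All (NotDom i) B →
  countDom i (fill (A ++ dom i ∷ B)) ≡ payoff (map shape A) (map shape B)
countDom-fill-seed i A B na nb = countDom-fillFrom-seed i A B free 0 free na nb refl refl

-- The best an entrant can get inside a gap of a free vertices between the cells L and R.
entryValue : Cell → ℕ → Cell → ℕ
entryValue dom° a dom° = ⌊ suc a /2⌋
entryValue dom° a free° = a
entryValue dom° a neutral° = a
entryValue free° a r = a
entryValue neutral° a r = a

maxEntry : Cell → ℕ → List Cell → ℕ
maxEntry l a [] = entryValue l a free°
maxEntry l a (free° ∷ w) = maxEntry l (suc a) w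
maxEntry l a (neutral° ∷ w) = entryValue l a neutral° ⊔ maxEntry neutral° 0 w
maxEntry l a (dom° ∷ w) = entryValue l a dom° ⊔ maxEntry dom° 0 w

maxEntryBeyond : List Cell → ℕ
maxEntryBeyond [] = 0
maxEntryBeyond (free° ∷ w) = maxEntryBeyond w
maxEntryBeyond (neutral° ∷ w) = maxEntry neutral° 0 w
maxEntryBeyond (dom° ∷ w) = maxEntry dom° 0 w

rightGapLength : List Cell → ℕ
rightGapLength B = proj₁ (rightGap B free°)
rightGapEnd : List Cell → Cell
rightGapEnd B = proj₂ (rightGap B free°)

maxEntry-rightGap : ∀ l c B →
  maxEntry l c B ≡ entryValue l (c + rightGapLength B) (rightGapEnd B) ⊔ maxEntryBeyond B
maxEntry-rightGap l c [] rewrite +-identityʳ c | ⊔-identityʳ (entryValue l c free°) = refl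
maxEntry-rightGap l c (free° ∷ B) rewrite maxEntry-rightGap l (suc c) B | +-suc c (rightGapLength B) = refl
maxEntry-rightGap l c (neutral° ∷ B) rewrite +-identityʳ c = refl
maxEntry-rightGap l c (dom° ∷ B) rewrite +-identityʳ c = refl

⌊/2⌋-superadditive : ∀ a m → ⌊ a /2⌋ + ⌊ m /2⌋ ≤ ⌊ a + m /2⌋
⌊/2⌋-superadditive zero m = ≤-refl
⌊/2⌋-superadditive (suc zero) m = ⌊n/2⌋-mono (n≤1+n m)
⌊/2⌋-superadditive (suc (suc a)) m = s≤s (⌊/2⌋-superadditive a m)

share+share≤entryValue : ∀ L a m R → share L a + suc (share R m) ≤ entryValue L (suc a + m) R
share+share≤entryValue dom° a m dom° = ≤-trans (≤-reflexive (+-suc ⌊ a /2⌋ ⌊ m /2⌋))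
  (s≤s (⌊/2⌋-superadditive a m))
share+share≤entryValue dom° a m free° = ≤-trans (≤-reflexive (+-suc _ m)) (s≤s (+-monoˡ-≤ m (⌊n/2⌋≤n a)))
share+share≤entryValue dom° a m neutral° = ≤-trans (≤-reflexive (+-suc _ m)) (s≤s (+-monoˡ-≤ m (⌊n/2⌋≤n a)))
share+share≤entryValue free° a m dom° = ≤-trans (≤-reflexive (+-suc a _)) (s≤s (+-monoʳ-≤ a (⌊n/2⌋≤n m)))
share+share≤entryValue free° a m free° = ≤-reflexive (+-suc a m)
share+share≤entryValue free° a m neutral° = ≤-reflexive (+-suc a m)
share+share≤entryValue neutral° a m dom° = ≤-trans (≤-reflexive (+-suc a _)) (s≤s (+-monoʳ-≤ a (⌊n/2⌋≤n m)))
share+share≤entryValue neutral° a m free° = ≤-reflexive (+-suc a m)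
share+share≤entryValue neutral° a m neutral° = ≤-reflexive (+-suc a m)

payoff≤maxEntry′ : ∀ A B l a →
  share (proj₁ (leftGap l a A)) (proj₂ (leftGap l a A)) + suc (rightShare B) ≤ maxEntry l a (A ++ free° ∷ B)
payoff≤maxEntry′ [] B l a rewrite maxEntry-rightGap l (suc a) B =
  ≤-trans (share+share≤entryValue l a (rightGapLength B) (rightGapEnd B)) (m≤m⊔n _ _)
payoff≤maxEntry′ (free° ∷ A) B l a = payoff≤maxEntry′ A B l (suc a)
payoff≤maxEntry′ (neutral° ∷ A) B l a = ≤-trans (payoff≤maxEntry′ A B neutral° 0) (m≤n⊔m _ _)
payoff≤maxEntry′ (dom° ∷ A) B l a = ≤-trans (payoff≤maxEntry′ A B dom° 0) (m≤n⊔m _ _)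

payoff≤maxEntry : ∀ A B → payoff A B ≤ maxEntry free° 0 (A ++ free° ∷ B)
payoff≤maxEntry A B = payoff≤maxEntry′ A B free° 0

vacatedEntry : List Cell → List Cell → ℕ
vacatedEntry A B = entryValue (proj₁ (leftGap free° 0 A)) (proj₂ (leftGap free° 0 A) + suc (rightGapLength B)) (rightGapEnd B)

maxEntry-vacate′ : ∀ A B l a → maxEntry l a (A ++ free° ∷ B) ≤
  maxEntry l a (A ++ dom° ∷ B) ⊔ entryValue (proj₁ (leftGap l a A)) (proj₂ (leftGap l a A) + suc (rightGapLength B)) (rightGapEnd B)
maxEntry-vacate′ [] B l a rewrite maxEntry-rightGap l (suc a) B | maxEntry-rightGap dom° 0 B | +-suc a (rightGapLength B) =
  ⊔-lub (m≤n⊔m _ _) (≤-trans (m≤n⊔m (entryValue dom° (rightGapLength B) (rightGapEnd B)) (maxEntryBeyond B))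
    (≤-trans (m≤n⊔m (entryValue l a dom°) _) (m≤m⊔n _ _)))
maxEntry-vacate′ (free° ∷ A) B l a = maxEntry-vacate′ A B l (suc a)
maxEntry-vacate′ (neutral° ∷ A) B l a = ≤-trans (⊔-monoʳ-≤ (entryValue l a neutral°) (maxEntry-vacate′ A B neutral° 0))
  (≤-reflexive (sym (⊔-assoc (entryValue l a neutral°) _ _)))
maxEntry-vacate′ (dom° ∷ A) B l a = ≤-trans (⊔-monoʳ-≤ (entryValue l a dom°) (maxEntry-vacate′ A B dom° 0))
  (≤-reflexive (sym (⊔-assoc (entryValue l a dom°) _ _)))

-- A deviating player can only enter a gap that was there before, or the gap merged by
-- its own departure.
maxEntry-vacate : ∀ A B → maxEntry free° 0 (A ++ free° ∷ B) ≤ maxEntry free° 0 (A ++ dom° ∷ B) ⊔ vacatedEntry A B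
maxEntry-vacate A B = maxEntry-vacate′ A B free° 0

-- Statuses at time 1

filter-unclaimed : (s : Profile κ n) → ∀ u → (∀ j → ¬ s j ≡ u) → ∀ xs → filter (λ j → s j ≟ u) xs ≡ []
filter-unclaimed s u h [] = refl
filter-unclaimed s u h (x ∷ xs) with s x ≟ u
... | yes e = ⊥-elim (h x e)
... | no _ = filter-unclaimed s u h xs

filter-claimants : (s : Profile κ n) → ∀ u → ∀ xs → All (λ j → s j ≡ u) (filter (λ j → s j ≟ u) xs)
filter-claimants s u [] = []
filter-claimants s u (x ∷ xs) with s x ≟ u
... | yes e = e ∷ filter-claimants s u xs
... | no _ = filter-claimants s u xs

filter-claimant : (s : Profile κ n) → ∀ u → ∀ {j} xs → j ∈ xs → s j ≡ u → j ∈ filter (λ j → s j ≟ u) xs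
filter-claimant s u (x ∷ xs) (here refl) e with s x ≟ u
... | yes _ = here refl
... | no ne = ⊥-elim (ne e)
filter-claimant s u (x ∷ xs) (there m) e with s x ≟ u
... | yes _ = there (filter-claimant s u xs m e)
... | no _ = filter-claimant s u xs m e

All-lookup∈ : ∀ {P : T → Set} {xs x} → All P xs → x ∈ xs → P x
All-lookup∈ (p ∷ ps) (here refl) = p
All-lookup∈ (p ∷ ps) (there m) = All-lookup∈ ps m

allB⇒All : (x : Fin κ) → ∀ xs → allB (λ y → does (x ≟ y)) xs ≡ true → All (λ y → y ≡ x) xs
allB⇒All x [] e = []
allB⇒All x (y ∷ ys) e with x ≟ y
... | yes refl = refl ∷ allB⇒All x ys e
... | no _ = ⊥-elim (case e) where
  case : false ≡ true → ⊥
  case ()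

All⇒allB : (x : Fin κ) → ∀ xs → All (λ y → y ≡ x) xs → allB (λ y → does (x ≟ y)) xs ≡ true
All⇒allB x [] _ = refl
All⇒allB x (y ∷ ys) (refl ∷ ps) rewrite does-≟-refl x = All⇒allB x ys ps

classify-unanimous : ∀ (j : Fin κ) → ∀ xs → j ∈ xs → All (λ y → y ≡ j) xs → classify xs ≡ dom j
classify-unanimous j (x ∷ xs) m (refl ∷ ps) rewrite All⇒allB x xs ps = refl

classify-contested : ∀ (j k : Fin κ) → ∀ xs → j ∈ xs → k ∈ xs → ¬ j ≡ k → classify xs ≡ neutral
classify-contested j k (x ∷ xs) mj mk ne with allB (λ y → does (x ≟ y)) xs in eq
... | false = refl
... | true = ⊥-elim (ne (trans (f mj) (sym (f mk))))
  where
  al = allB⇒All x xs eq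
  f : ∀ {y} → y ∈ (x ∷ xs) → y ≡ x
  f (here refl) = refl
  f (there m) = All-lookup∈ al m

classify-dom⇒∈ : ∀ (xs : List (Fin κ)) → ∀ y → classify xs ≡ dom y → y ∈ xs
classify-dom⇒∈ (x ∷ xs) y e with allB (λ z → does (x ≟ z)) xs
classify-dom⇒∈ (x ∷ xs) y refl | true = here refl
classify-dom⇒∈ (x ∷ xs) y () | false

classify-NotDom : ∀ (i : Fin κ) → ∀ xs → ¬ i ∈ xs → NotDom i (classify xs)
classify-NotDom i xs ni with classify xs in eq
... | free = refl
... | neutral = refl
... | dom y with i ≟ y
...   | yes refl = ⊥-elim (ni (classify-dom⇒∈ xs y eq))
...   | no _ = refl

initial-unclaimed : (s : Profile κ n) → ∀ u → ¬ (∃ λ j → s j ≡ u) → initial s u ≡ free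
initial-unclaimed s u unclaimed = cong classify (filter-unclaimed s u (λ j e → unclaimed (j , e)) (allFin _))

initial-claimedBy : (s : Profile κ n) → ∀ u j → s j ≡ u → (∀ k → s k ≡ u → k ≡ j) → initial s u ≡ dom j
initial-claimedBy s u j e h = classify-unanimous j _ (filter-claimant s u (allFin _) (∈-allFin j) e)
  (allmap (filter-claimants s u (allFin _)))
  where
  allmap : ∀ {xs} → All (λ k → s k ≡ u) xs → All (λ k → k ≡ j) xs
  allmap [] = []
  allmap (p ∷ ps) = h _ p ∷ allmap ps

initial-collision : (s : Profile κ n) → ∀ u j k → s j ≡ u → s k ≡ u → ¬ j ≡ k → initial s u ≡ neutral
initial-collision s u j k ej ek ne = classify-contested j k _ (filter-claimant s u (allFin _) (∈-allFin j) ej)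
  (filter-claimant s u (allFin _) (∈-allFin k) ek) ne

initial-NotDom : (s : Profile κ n) → ∀ u i → ¬ s i ≡ u → NotDom i (initial s u)
initial-NotDom s u i ne = classify-NotDom i _ (λ m → ne (All-lookup∈ (filter-claimants s u (allFin _)) m))

Distinct : Profile κ n → Set
Distinct {κ} s = ∀ (i j : Fin κ) → s i ≡ s j → i ≡ j

initial-seed : (s : Profile κ n) → Distinct s → ∀ {u} j → s j ≡ u → initial s u ≡ dom j
initial-seed s distinct {u} j sj≡u = initial-claimedBy s u j sj≡u (λ k sk≡u → distinct k j (trans sk≡u (sym sj≡u)))

U-collision : (s : Profile κ n) → ∀ i j → s i ≡ s j → ¬ i ≡ j → U (pathGraph n) s i ≡ 0
U-collision s i j e i≢j = trans (U-path s i)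
  (countDom-fillFrom-absent i _ free 0 free (tabulate⁺ not-i) refl refl)
  where
  not-i : ∀ u → NotDom i (initial s u)
  not-i u with s i ≟ u
  ... | yes si≡u = subst (NotDom i) (sym (initial-collision s u i j si≡u (trans (sym e) si≡u) i≢j)) refl
  ... | no si≢u = initial-NotDom s u i si≢u

distinct-if-U-positive : (s : Profile κ n) → (∀ i → 1 ≤ U (pathGraph n) s i) → Distinct s
distinct-if-U-positive s positive i j e with i ≟ j
... | yes i≡j = i≡j
... | no i≢j with subst (1 ≤_) (U-collision s i j e i≢j) (positive i)
...   | ()

isDom-initial : (s : Profile κ n) → Distinct s → ∀ i u → isDom i (initial s u) ≡ does (s i ≟ u)
isDom-initial s distinct i u with s i ≟ u
... | yes si≡u = trans (cong (isDom i) (initial-seed s distinct i si≡u)) (does-≟-refl i)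
... | no si≢u = initial-NotDom s u i si≢u

countDom-tabulate-absent : ∀ {n} (i : Fin κ) (f : Fin n → Status κ) → (∀ u → NotDom i (f u)) →
  countDom i (tabulate f) ≡ 0
countDom-tabulate-absent {n = zero} i f h = refl
countDom-tabulate-absent {n = suc n} i f h rewrite h zero = countDom-tabulate-absent i (f ∘ suc) (h ∘ suc)

countDom-tabulate-once : ∀ {n} (i : Fin κ) (f : Fin n → Status κ) → ∀ v → (∀ u → isDom i (f u) ≡ does (v ≟ u)) →
  countDom i (tabulate f) ≡ 1
countDom-tabulate-once i f zero h rewrite h zero = cong suc (countDom-tabulate-absent i (f ∘ suc) (h ∘ suc))
countDom-tabulate-once i f (suc v) h rewrite h zero = countDom-tabulate-once i (f ∘ suc) v (h ∘ suc)

word : Profile κ n → List Cell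
word s = map shape (layout s)

countDom-layout : (s : Profile κ n) → Distinct s → ∀ i → countDom i (layout s) ≡ 1
countDom-layout s distinct i = countDom-tabulate-once i (initial s) (s i) (isDom-initial s distinct i)

modifyAt : (Fin n → T) → Fin n → (T → T) → Fin n → T
modifyAt f v h u = if does (v ≟ u) then h (f u) else f u

vacate : Profile κ n → Fin κ → Fin n → Status κ
vacate s i = modifyAt (initial s) (s i) (λ _ → free)

tabulate-split : ∀ {n} (f : Fin n → T) → ∀ v → Σ (List T) λ C → Σ (List T) λ D →
  tabulate f ≡ C ++ f v ∷ D × length C ≡ toℕ v
tabulate-split f zero = [] , tabulate (f ∘ suc) , refl , refl
tabulate-split f (suc v) with tabulate-split (f ∘ suc) v
... | C , D , e , l = f zero ∷ C , D , cong (f zero ∷_) e , cong suc l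

tabulate-modifyAt : ∀ {n} (f : Fin n → T) → ∀ v h C y D → tabulate f ≡ C ++ y ∷ D → length C ≡ toℕ v →
  tabulate (modifyAt f v h) ≡ C ++ h y ∷ D
tabulate-modifyAt {n = suc n} f zero h [] y D e l = cong₂ _∷_ (cong h (proj₁ (∷-injective e))) (proj₂ (∷-injective e))
tabulate-modifyAt {n = suc n} f (suc v) h (c ∷ C) y D e l =
  cong₂ _∷_ (proj₁ (∷-injective e)) (tabulate-modifyAt (f ∘ suc) v h C y D (proj₂ (∷-injective e)) (suc-injective l))

map-split : ∀ {Y : Set} (g : T → Y) → ∀ xs C x D → map g xs ≡ C ++ x ∷ D →
  Σ (List T) λ C' → Σ T λ y → Σ (List T) λ D' →
  xs ≡ C' ++ y ∷ D' × map g C' ≡ C × g y ≡ x × map g D' ≡ D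
map-split g (z ∷ xs) [] x D e = [] , z , xs , refl , refl , proj₁ (∷-injective e) , proj₂ (∷-injective e)
map-split g (z ∷ xs) (c ∷ C) x D e with map-split g xs C x D (proj₂ (∷-injective e))
... | C' , y , D' , f1 , f2 , f3 , f4 = z ∷ C' , y , D' , cong (z ∷_) f1 , cong₂ _∷_ (proj₁ (∷-injective e)) f2 , f3 , f4

length-prefix< : ∀ (L A : List T) x B → L ≡ A ++ x ∷ B → length A < length L
length-prefix< L A x B refl rewrite length-++ A {x ∷ B} = m<m+n (length A) (s≤s z≤n)

index-of-prefix : ∀ {L C : List T} {x D} → length L ≡ n → L ≡ C ++ x ∷ D → Σ (Fin n) λ v → length C ≡ toℕ v
index-of-prefix {L = L} {C} {x} {D} len eq = fromℕ< lt , sym (toℕ-fromℕ< lt)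
  where
  lt = subst (length C <_) len (length-prefix< L C x D eq)

countDom-seed-split : (i : Fin κ) → ∀ A B → countDom i (A ++ dom i ∷ B) ≡ 1 → countDom i A ≡ 0 × countDom i B ≡ 0
countDom-seed-split i A B e rewrite countDom-++ i A (dom i ∷ B) | does-≟-refl i with countDom i A | countDom i B
... | zero | zero = refl , refl
... | zero | suc b = ⊥-elim (0≢1+n (sym (suc-injective e)))
... | suc a | b = ⊥-elim (0≢1+n (sym (trans (sym (+-suc a b)) (suc-injective e))))

countDom≡0⇒NotDom : (i : Fin κ) → ∀ xs → countDom i xs ≡ 0 → All (NotDom i) xs
countDom≡0⇒NotDom i [] e = []
countDom≡0⇒NotDom i (x ∷ xs) e with isDom i x in eq
... | true = ⊥-elim (1+n≢0 e)
... | false = eq ∷ countDom≡0⇒NotDom i xs e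

NotDom-around-seed : ∀ {i : Fin κ} {A B} → countDom i (A ++ dom i ∷ B) ≡ 1 → All (NotDom i) A × All (NotDom i) B
NotDom-around-seed {i = i} {A} {B} once with countDom-seed-split i A B once
... | a , b = countDom≡0⇒NotDom i A a , countDom≡0⇒NotDom i B b

countDom-seed-positive : (i : Fin κ) → ∀ A B → 1 ≤ countDom i (A ++ dom i ∷ B)
countDom-seed-positive i A B rewrite countDom-++ i A (dom i ∷ B) | does-≟-refl i = ≤-trans (s≤s z≤n) (m≤n+m _ (countDom i A))

countDom-tail-once : (i : Fin κ) → ∀ x xs → countDom i (x ∷ xs) ≡ 1 → 1 ≤ countDom i xs → countDom i xs ≡ 1
countDom-tail-once i x xs e p with isDom i x
... | false = e
... | true rewrite suc-injective e with p
... | ()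

countDom-seed≢0 : (i : Fin κ) → ∀ A B → ¬ countDom i (A ++ dom i ∷ B) ≡ 0
countDom-seed≢0 i A B e with countDom-seed-positive i A B
... | p rewrite e with p
... | ()

seed-position-unique : (i : Fin κ) → ∀ A B C D → countDom i (A ++ dom i ∷ B) ≡ 1 →
  A ++ dom i ∷ B ≡ C ++ dom i ∷ D →
  length A ≡ length C
seed-position-unique i [] B [] D c e = refl
seed-position-unique i [] B (y ∷ C) D c e =
  ⊥-elim (countDom-seed≢0 i C D (subst (λ z → countDom i z ≡ 0) (proj₂ (∷-injective e)) (proj₂ (countDom-seed-split i [] B c))))
seed-position-unique i (x ∷ A) B [] D c e =
  ⊥-elim (countDom-seed≢0 i A B (subst (λ z → countDom i z ≡ 0) (sym (proj₂ (∷-injective e)))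
    (proj₂ (countDom-seed-split i [] D (subst (λ z → countDom i z ≡ 1) e c)))))
seed-position-unique i (x ∷ A) B (y ∷ C) D c e =
  cong suc (seed-position-unique i A B C D (countDom-tail-once i x (A ++ dom i ∷ B) c (countDom-seed-positive i A B)) (proj₂ (∷-injective e)))

NotDom-around-layout : (s : Profile κ n) → Distinct s → ∀ {i A B} → layout s ≡ A ++ dom i ∷ B →
  All (NotDom i) A × All (NotDom i) B
NotDom-around-layout s distinct {i} eq = NotDom-around-seed (subst (λ L → countDom i L ≡ 1) eq (countDom-layout s distinct i))

vacate-layout : (s : Profile κ n) → Distinct s → ∀ {i A B} → layout s ≡ A ++ dom i ∷ B →
  tabulate (vacate s i) ≡ A ++ free ∷ B
vacate-layout s distinct {i} {A} {B} eq = tabulate-modifyAt (initial s) (s i) (λ _ → free) A (dom i) B eq at-seed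
  where
  at-seed : length A ≡ toℕ (s i)
  at-seed with tabulate-split (initial s) (s i)
  ... | A' , B' , eq' , len' = trans (seed-position-unique i A B A' B'
    (subst (λ L → countDom i L ≡ 1) eq (countDom-layout s distinct i))
    (trans (sym eq) (trans eq' (cong (λ z → A' ++ z ∷ B') (initial-seed s distinct i refl))))) len'

extend-inject₁ : ∀ {κ} (s : Profile κ n) v (j : Fin κ) → extend s v (inject₁ j) ≡ s j
extend-inject₁ {κ = suc κ} s v zero = refl
extend-inject₁ {κ = suc κ} s v (suc j) = extend-inject₁ (s ∘ suc) v j

extend-fromℕ : ∀ {κ} (s : Profile κ n) v → extend s v (fromℕ κ) ≡ v
extend-fromℕ {κ = zero} s v = refl
extend-fromℕ {κ = suc κ} s v = extend-fromℕ (s ∘ suc) v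

fromℕ-or-inject₁ : ∀ {κ} (k : Fin (suc κ)) → k ≡ fromℕ κ ⊎ Σ (Fin κ) λ j → k ≡ inject₁ j
fromℕ-or-inject₁ {κ = zero} zero = inj₁ refl
fromℕ-or-inject₁ {κ = suc κ} zero = inj₂ (zero , refl)
fromℕ-or-inject₁ {κ = suc κ} (suc k) with fromℕ-or-inject₁ k
... | inj₁ e = inj₁ (cong suc e)
... | inj₂ (j , e) = inj₂ (suc j , cong suc e)

extend-claim : (s : Profile κ n) → ∀ v k {u} → extend s v k ≡ u →
  (k ≡ fromℕ κ × v ≡ u) ⊎ Σ (Fin κ) λ j → k ≡ inject₁ j × s j ≡ u
extend-claim s v k e with fromℕ-or-inject₁ k
... | inj₁ refl = inj₁ (refl , trans (sym (extend-fromℕ s v)) e)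
... | inj₂ (j , refl) = inj₂ (j , refl , trans (sym (extend-inject₁ s v j)) e)

liftStatus : Status κ → Status (suc κ)
liftStatus free = free
liftStatus neutral = neutral
liftStatus (dom j) = dom (inject₁ j)

enter : Fin κ → Status κ → Status κ
enter i free = dom i
enter i neutral = neutral
enter i (dom _) = neutral

claimed? : (s : Profile κ n) → ∀ u → Dec (∃ λ j → s j ≡ u)
claimed? s u = any? (λ j → s j ≟ u)

initial-extend : (s : Profile κ n) → Distinct s → ∀ v u →
  initial (extend s v) u ≡ modifyAt (liftStatus ∘ initial s) v (enter (fromℕ κ)) u
initial-extend {κ = κ} s distinct v u with v ≟ u | claimed? s u
... | yes v≡u | yes (j , sj≡u) =
  trans (initial-collision (extend s v) u (inject₁ j) (fromℕ κ) (trans (extend-inject₁ s v j) sj≡u)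
           (trans (extend-fromℕ s v) v≡u) (λ q → fromℕ≢inject₁ (sym q)))
        (sym (cong (enter (fromℕ κ) ∘ liftStatus) (initial-seed s distinct j sj≡u)))
... | yes v≡u | no unclaimed =
  trans (initial-claimedBy (extend s v) u (fromℕ κ) (trans (extend-fromℕ s v) v≡u) only-new)
        (sym (cong (enter (fromℕ κ) ∘ liftStatus) (initial-unclaimed s u unclaimed)))
  where
  only-new : ∀ k → extend s v k ≡ u → k ≡ fromℕ κ
  only-new k e with extend-claim s v k e
  ... | inj₁ (k≡new , _) = k≡new
  ... | inj₂ (j , _ , sj≡u) = ⊥-elim (unclaimed (j , sj≡u))
... | no v≢u | yes (j , sj≡u) =
  trans (initial-claimedBy (extend s v) u (inject₁ j) (trans (extend-inject₁ s v j) sj≡u) only-j)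
        (sym (cong liftStatus (initial-seed s distinct j sj≡u)))
  where
  only-j : ∀ k → extend s v k ≡ u → k ≡ inject₁ j
  only-j k e with extend-claim s v k e
  ... | inj₁ (_ , v≡u) = ⊥-elim (v≢u v≡u)
  ... | inj₂ (j' , refl , sj'≡u) = cong inject₁ (distinct j' j (trans sj'≡u (sym sj≡u)))
... | no v≢u | no unclaimed =
  trans (initial-unclaimed (extend s v) u nobody) (sym (cong liftStatus (initial-unclaimed s u unclaimed)))
  where
  nobody : ¬ ∃ λ k → extend s v k ≡ u
  nobody (k , e) with extend-claim s v k e
  ... | inj₁ (_ , v≡u) = v≢u v≡u
  ... | inj₂ (j , _ , sj≡u) = unclaimed (j , sj≡u)

update-self : (s : Profile κ n) → ∀ i v → update s i v i ≡ v
update-self s i v with i ≟ i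
... | yes _ = refl
... | no i≢i = ⊥-elim (i≢i refl)

update-other : (s : Profile κ n) → ∀ i v {k} → ¬ k ≡ i → update s i v k ≡ s k
update-other s i v {k} k≢i with i ≟ k
... | yes refl = ⊥-elim (k≢i refl)
... | no _ = refl

update-claim : (s : Profile κ n) → ∀ i v k {u} → update s i v k ≡ u → (k ≡ i × v ≡ u) ⊎ (¬ k ≡ i × s k ≡ u)
update-claim s i v k e with i ≟ k
... | yes refl = inj₁ (refl , e)
... | no i≢k = inj₂ ((λ q → i≢k (sym q)) , e)

initial-update-target : (s : Profile κ n) → Distinct s → ∀ i u → initial (update s i u) u ≡ enter i (vacate s i u)
initial-update-target s distinct i u with s i ≟ u | claimed? s u
... | yes si≡u | _ = initial-claimedBy (update s i u) u i (update-self s i u) only-i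
  where
  only-i : ∀ k → update s i u k ≡ u → k ≡ i
  only-i k e with update-claim s i u k e
  ... | inj₁ (k≡i , _) = k≡i
  ... | inj₂ (_ , sk≡u) = distinct k i (trans sk≡u (sym si≡u))
... | no si≢u | yes (j , sj≡u) =
  trans (initial-collision (update s i u) u i j (update-self s i u) (trans (update-other s i u j≢i) sj≡u) (λ i≡j → j≢i (sym i≡j)))
        (sym (cong (enter i) (initial-seed s distinct j sj≡u)))
  where
  j≢i : ¬ j ≡ i
  j≢i refl = si≢u sj≡u
... | no si≢u | no unclaimed =
  trans (initial-claimedBy (update s i u) u i (update-self s i u) only-i)
        (sym (cong (enter i) (initial-unclaimed s u unclaimed)))
  where
  only-i : ∀ k → update s i u k ≡ u → k ≡ i
  only-i k e with update-claim s i u k e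
  ... | inj₁ (k≡i , _) = k≡i
  ... | inj₂ (_ , sk≡u) = ⊥-elim (unclaimed (k , sk≡u))

initial-update-elsewhere : (s : Profile κ n) → Distinct s → ∀ i {v u} → ¬ v ≡ u →
  initial (update s i v) u ≡ vacate s i u
initial-update-elsewhere s distinct i {v} {u} v≢u with s i ≟ u | claimed? s u
... | yes si≡u | _ = initial-unclaimed (update s i v) u nobody
  where
  nobody : ¬ ∃ λ k → update s i v k ≡ u
  nobody (k , e) with update-claim s i v k e
  ... | inj₁ (_ , v≡u) = v≢u v≡u
  ... | inj₂ (k≢i , sk≡u) = k≢i (distinct k i (trans sk≡u (sym si≡u)))
... | no si≢u | yes (j , sj≡u) =
  trans (initial-claimedBy (update s i v) u j (trans (update-other s i v j≢i) sj≡u) only-j)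
        (sym (initial-seed s distinct j sj≡u))
  where
  j≢i : ¬ j ≡ i
  j≢i refl = si≢u sj≡u
  only-j : ∀ k → update s i v k ≡ u → k ≡ j
  only-j k e with update-claim s i v k e
  ... | inj₁ (_ , v≡u) = ⊥-elim (v≢u v≡u)
  ... | inj₂ (_ , sk≡u) = distinct k j (trans sk≡u (sym sj≡u))
... | no si≢u | no unclaimed = trans (initial-unclaimed (update s i v) u nobody) (sym (initial-unclaimed s u unclaimed))
  where
  nobody : ¬ ∃ λ k → update s i v k ≡ u
  nobody (k , e) with update-claim s i v k e
  ... | inj₁ (_ , v≡u) = v≢u v≡u
  ... | inj₂ (_ , sk≡u) = unclaimed (k , sk≡u)

initial-update : (s : Profile κ n) → Distinct s → ∀ i v u →
  initial (update s i v) u ≡ modifyAt (vacate s i) v (enter i) u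
initial-update s distinct i v u with v ≟ u
... | yes refl = initial-update-target s distinct i u
... | no v≢u = initial-update-elsewhere s distinct i v≢u

≤-⊓∞⁻ : ∀ t x y → fin t ≤∞ (x ⊓∞ y) → fin t ≤∞ x × fin t ≤∞ y
≤-⊓∞⁻ t (fin a) (fin b) (fin≤fin p) = fin≤fin (≤-trans p (m⊓n≤m a b)) , fin≤fin (≤-trans p (m⊓n≤n a b))
≤-⊓∞⁻ t (fin a) ∞ p = p , ≤∞∞
≤-⊓∞⁻ t ∞ y p = ≤∞∞ , p

≤-⊓∞ : ∀ t x y → fin t ≤∞ x → fin t ≤∞ y → fin t ≤∞ (x ⊓∞ y)
≤-⊓∞ t (fin a) (fin b) (fin≤fin p) (fin≤fin q) = fin≤fin (⊓-glb p q)
≤-⊓∞ t (fin a) ∞ p q = p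
≤-⊓∞ t ∞ y p q = q

≤-minFin⁻ : ∀ {κ} t (g : Fin κ → ℕ) → fin t ≤∞ minFin (λ i → fin (g i)) → ∀ i → t ≤ g i
≤-minFin⁻ t g p zero with ≤-⊓∞⁻ t (fin (g zero)) (minFin (λ x → fin (g (suc x)))) p
... | fin≤fin q , _ = q
≤-minFin⁻ t g p (suc i) = ≤-minFin⁻ t (g ∘ suc) (proj₂ (≤-⊓∞⁻ t (fin (g zero)) (minFin (λ x → fin (g (suc x)))) p)) i

≤-minFin : ∀ {κ} t (g : Fin κ → ℕ) → (∀ i → t ≤ g i) → fin t ≤∞ minFin (λ i → fin (g i))
≤-minFin {κ = zero} t g h = ≤∞∞
≤-minFin {κ = suc κ} t g h = ≤-⊓∞ t (fin (g zero)) (minFin (λ x → fin (g (suc x)))) (fin≤fin (h zero)) (≤-minFin t (g ∘ suc) (h ∘ suc))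

maxFin-≤ : ∀ {m} t (f : Fin m → ℕ) → (∀ v → f v ≤ t) → maxFin f ≤ t
maxFin-≤ {m = zero} t f h = z≤n
maxFin-≤ {m = suc m} t f h = ⊔-lub (h zero) (maxFin-≤ t (f ∘ suc) (h ∘ suc))

≤-maxFin : ∀ {m} (f : Fin m → ℕ) v → f v ≤ maxFin f
≤-maxFin f zero = m≤m⊔n _ _
≤-maxFin f (suc v) = ≤-trans (≤-maxFin (f ∘ suc) v) (m≤n⊔m _ _)

NeutralFree : List Cell → Set
NeutralFree = All (λ x → ¬ x ≡ neutral°)

seeds : List Cell → ℕ
seeds [] = 0
seeds (dom° ∷ w) = suc (seeds w)
seeds (free° ∷ w) = seeds w
seeds (neutral° ∷ w) = seeds w

-- The three conditions of Admits on the word: ν ≤ t, t ≤ μ, and no profitable deviation.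
record Admissible (t : ℕ) (w : List Cell) : Set where
  constructor admissible
  field
    entrant≤ : ∀ A B → w ≡ A ++ free° ∷ B → payoff A B ≤ t
    ≤seed : ∀ A B → w ≡ A ++ dom° ∷ B → t ≤ payoff A B
    no-deviation : ∀ A B → w ≡ A ++ dom° ∷ B → ∀ C E → A ++ free° ∷ B ≡ C ++ free° ∷ E → payoff C E ≤ payoff A B

AdmitsWord : ℕ → ℕ → ℕ → Set
AdmitsWord n κ t = Σ (List Cell) λ w → length w ≡ n × NeutralFree w × seeds w ≡ κ × Admissible t w

map-shape-liftStatus : (xs : List (Status κ)) → map shape (map liftStatus xs) ≡ map shape xs
map-shape-liftStatus [] = refl
map-shape-liftStatus (free ∷ xs) = cong (free° ∷_) (map-shape-liftStatus xs)
map-shape-liftStatus (neutral ∷ xs) = cong (neutral° ∷_) (map-shape-liftStatus xs)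
map-shape-liftStatus (dom _ ∷ xs) = cong (dom° ∷_) (map-shape-liftStatus xs)

NotDom-liftStatus : (x : Status κ) → NotDom (fromℕ κ) (liftStatus x)
NotDom-liftStatus free = refl
NotDom-liftStatus neutral = refl
NotDom-liftStatus {κ} (dom j) = dec-false (fromℕ κ ≟ inject₁ j) fromℕ≢inject₁

dom°⇒dom : (y : Status κ) → shape y ≡ dom° → Σ (Fin κ) λ i → y ≡ dom i
dom°⇒dom (dom i) _ = i , refl

seed-split : (L : List (Status κ)) → ∀ {A B} → map shape L ≡ A ++ dom° ∷ B →
  Σ (Fin κ) λ i → Σ (List (Status κ)) λ A' → Σ (List (Status κ)) λ B' →
  L ≡ A' ++ dom i ∷ B' × map shape A' ≡ A × map shape B' ≡ B
seed-split L {A} {B} e with map-split shape L A dom° B e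
... | A' , y , B' , eL , eA , ey , eB with dom°⇒dom y ey
...   | i , refl = i , A' , B' , eL , eA , eB

ifFree : Status κ → ℕ → ℕ
ifFree free m = m
ifFree neutral m = 0
ifFree (dom _) m = 0

ifFree-free° : ∀ {x : Status κ} m → shape x ≡ free° → ifFree x m ≡ m
ifFree-free° {x = free} m _ = refl

ifFree-liftStatus : ∀ (x : Status κ) m → ifFree (liftStatus x) m ≡ ifFree x m
ifFree-liftStatus free m = refl
ifFree-liftStatus neutral m = refl
ifFree-liftStatus (dom _) m = refl

ifFree-≤ : (x : Status κ) → ∀ m t → (x ≡ free → m ≤ t) → ifFree x m ≤ t
ifFree-≤ free m t h = h refl
ifFree-≤ neutral m t h = z≤n
ifFree-≤ (dom _) m t h = z≤n

countDom-fill-enter : (i : Fin κ) → ∀ C D x → All (NotDom i) C → All (NotDom i) D →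
  countDom i (fill (C ++ enter i x ∷ D)) ≡ ifFree x (payoff (map shape C) (map shape D))
countDom-fill-enter i C D free nC nD = countDom-fill-seed i C D nC nD
countDom-fill-enter i C D neutral nC nD = countDom-fillFrom-absent i (C ++ neutral ∷ D) free 0 free (++⁺ nC (refl ∷ nD)) refl refl
countDom-fill-enter i C D (dom _) nC nD = countDom-fillFrom-absent i (C ++ neutral ∷ D) free 0 free (++⁺ nC (refl ∷ nD)) refl refl

U-seed : (s : Profile κ n) → Distinct s → ∀ {i A B} → layout s ≡ A ++ dom i ∷ B →
  U (pathGraph n) s i ≡ payoff (map shape A) (map shape B)
U-seed s distinct {i} {A} {B} eq with NotDom-around-layout s distinct eq
... | notA , notB = trans (U-path s i) (trans (cong (countDom i ∘ fill) eq) (countDom-fill-seed i A B notA notB))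

U-extend-at : (s : Profile κ n) → Distinct s → ∀ {v C x D} → layout s ≡ C ++ x ∷ D → length C ≡ toℕ v →
  U (pathGraph n) (extend s v) (fromℕ κ) ≡ ifFree x (payoff (map shape C) (map shape D))
U-extend-at {κ} {n} s distinct {v} {C} {x} {D} eq len = begin
    U (pathGraph n) (extend s v) new
  ≡⟨ U-path (extend s v) new ⟩
    countDom new (fill (layout (extend s v)))
  ≡⟨ cong (countDom new ∘ fill) (trans (tabulate-cong (initial-extend s distinct v)) entered) ⟩
    countDom new (fill (map liftStatus C ++ enter new (liftStatus x) ∷ map liftStatus D))
  ≡⟨ countDom-fill-enter new _ _ (liftStatus x) (NotDom-lifted C) (NotDom-lifted D) ⟩
    ifFree (liftStatus x) (payoff (map shape (map liftStatus C)) (map shape (map liftStatus D)))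
  ≡⟨ trans (ifFree-liftStatus x _) (cong₂ (λ P Q → ifFree x (payoff P Q)) (map-shape-liftStatus C) (map-shape-liftStatus D)) ⟩
    ifFree x (payoff (map shape C) (map shape D)) ∎
  where
  open ≡-Reasoning
  new = fromℕ κ
  NotDom-lifted : ∀ xs → All (NotDom new) (map liftStatus xs)
  NotDom-lifted xs = map⁺ (universal NotDom-liftStatus xs)
  entered : tabulate (modifyAt (liftStatus ∘ initial s) v (enter new)) ≡ map liftStatus C ++ enter new (liftStatus x) ∷ map liftStatus D
  entered = tabulate-modifyAt (liftStatus ∘ initial s) v (enter new) _ _ _
    (trans (sym (map-tabulate (initial s) liftStatus)) (trans (cong (map liftStatus) eq) (map-++ liftStatus C (x ∷ D))))
    (trans (length-map liftStatus C) len)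

U-update-at : (s : Profile κ n) → Distinct s → ∀ {i A B v C x D} → layout s ≡ A ++ dom i ∷ B →
  tabulate (vacate s i) ≡ C ++ x ∷ D → length C ≡ toℕ v →
  U (pathGraph n) (update s i v) i ≡ ifFree x (payoff (map shape C) (map shape D))
U-update-at {n = n} s distinct {i} {A} {B} {v} {C} {x} {D} eq eqV len = begin
    U (pathGraph n) (update s i v) i
  ≡⟨ U-path (update s i v) i ⟩
    countDom i (fill (layout (update s i v)))
  ≡⟨ cong (countDom i ∘ fill) (trans (tabulate-cong (initial-update s distinct i v))
       (tabulate-modifyAt (vacate s i) v (enter i) C x D eqV len)) ⟩
    countDom i (fill (C ++ enter i x ∷ D))
  ≡⟨ countDom-fill-enter i C D x (++⁻ˡ C notCxD) (All-tail (++⁻ʳ C notCxD)) ⟩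
    ifFree x (payoff (map shape C) (map shape D)) ∎
  where
  open ≡-Reasoning
  notCxD : All (NotDom i) (C ++ x ∷ D)
  notCxD with NotDom-around-layout s distinct eq
  ... | notA , notB = subst (All (NotDom i)) (trans (sym (vacate-layout s distinct eq)) eqV) (++⁺ notA (refl ∷ notB))

∑-1 : ∀ κ → ∑ {κ} (λ _ → 1) ≡ κ
∑-1 zero = refl
∑-1 (suc κ) = cong suc (∑-1 κ)

∑-indicator-≟ : ∀ {κ} (j : Fin κ) → ∑ (λ i → indicator (does (i ≟ j))) ≡ 1
∑-indicator-≟ {suc κ} zero = cong suc (sum-replicate-zero κ)
∑-indicator-≟ {suc κ} (suc j) = ∑-indicator-≟ j

seeds-∷ : ∀ (x : Status κ) xs → seeds (map shape (x ∷ xs)) ≡ ∑ (λ i → indicator (isDom i x)) + seeds (map shape xs)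
seeds-∷ {κ} free xs = cong (_+ seeds (map shape xs)) (sym (sum-replicate-zero κ))
seeds-∷ {κ} neutral xs = cong (_+ seeds (map shape xs)) (sym (sum-replicate-zero κ))
seeds-∷ (dom j) xs = cong (_+ seeds (map shape xs)) (sym (∑-indicator-≟ j))

seeds-map-shape : (L : List (Status κ)) → seeds (map shape L) ≡ ∑ (λ i → countDom i L)
seeds-map-shape {κ} [] = sym (sum-replicate-zero κ)
seeds-map-shape (x ∷ L) = begin
    seeds (map shape (x ∷ L))
  ≡⟨ seeds-∷ x L ⟩
    ∑ (λ i → indicator (isDom i x)) + seeds (map shape L)
  ≡⟨ cong (∑ (λ i → indicator (isDom i x)) +_) (seeds-map-shape L) ⟩
    ∑ (λ i → indicator (isDom i x)) + ∑ (λ i → countDom i L)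
  ≡⟨ sym (∑-distrib-+ (λ i → indicator (isDom i x)) (λ i → countDom i L)) ⟩
    ∑ (λ i → indicator (isDom i x) + countDom i L)
  ∎
  where open ≡-Reasoning

seeds-word : (s : Profile κ n) → Distinct s → seeds (word s) ≡ κ
seeds-word {κ} s distinct = trans (seeds-map-shape (layout s)) (trans (sum-cong-≗ (countDom-layout s distinct)) (∑-1 κ))

NeutralFree-word : (s : Profile κ n) → Distinct s → NeutralFree (word s)
NeutralFree-word s distinct = map⁺ (tabulate⁺ not-neutral)
  where
  not-neutral : ∀ u → ¬ shape (initial s u) ≡ neutral°
  not-neutral u with claimed? s u
  ... | yes (j , sj≡u) rewrite initial-seed s distinct j sj≡u = λ ()
  ... | no unclaimed rewrite initial-unclaimed s u unclaimed = λ ()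

length-word : (s : Profile κ n) → length (word s) ≡ n
length-word s = trans (length-map shape (layout s)) (length-tabulate (initial s))

-- Equilibria as words

admits⇒admitsWord : ∀ {n κ t} → 1 ≤ t → Admits n κ t → AdmitsWord n κ t
admits⇒admitsWord {n} {κ} {t} 1≤t (s , nash , fin≤fin ν≤t , t≤μ) =
  word s , length-word s , NeutralFree-word s distinct , seeds-word s distinct , admissible entrant≤ ≤seed no-deviation
  where
  G = pathGraph n
  t≤U : ∀ i → t ≤ U G s i
  t≤U = ≤-minFin⁻ t (U G s) t≤μ
  distinct : Distinct s
  distinct = distinct-if-U-positive s (λ i → ≤-trans 1≤t (t≤U i))
  entrant≤ : ∀ A B → word s ≡ A ++ free° ∷ B → payoff A B ≤ t
  entrant≤ A B e with map-split shape (layout s) A free° B e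
  ... | C , x , D , eq , refl , x-free , refl with index-of-prefix (length-tabulate (initial s)) eq
  ... | v , len = ≤-trans (≤-reflexive (trans (sym (ifFree-free° _ x-free)) (sym (U-extend-at s distinct eq len))))
                    (≤-trans (≤-maxFin _ v) ν≤t)
  ≤seed : ∀ A B → word s ≡ A ++ dom° ∷ B → t ≤ payoff A B
  ≤seed A B e with seed-split (layout s) e
  ... | i , A' , B' , eq , refl , refl = subst (t ≤_) (U-seed s distinct eq) (t≤U i)
  no-deviation : ∀ A B → word s ≡ A ++ dom° ∷ B → ∀ C E → A ++ free° ∷ B ≡ C ++ free° ∷ E → payoff C E ≤ payoff A B
  no-deviation A B e C E e′ with seed-split (layout s) e
  ... | i , A' , B' , eq , refl , refl
    with map-split shape (tabulate (vacate s i)) C free° E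
           (trans (cong (map shape) (vacate-layout s distinct eq)) (trans (map-++ shape A' (free ∷ B')) e′))
  ... | C' , x , D' , eqV , refl , x-free , refl with index-of-prefix (length-tabulate (vacate s i)) eqV
  ... | v , len = subst₂ _≤_ (trans (U-update-at s distinct eq eqV len) (ifFree-free° _ x-free)) (U-seed s distinct eq) (nash i v)

findSeed : (i : Fin κ) → ∀ L → 1 ≤ countDom i L → Σ (List (Status κ)) λ A → Σ (List (Status κ)) λ B →
  L ≡ A ++ dom i ∷ B
findSeed i (x ∷ L) p with isDom i x in eq
... | false = let (A , B , e) = findSeed i L p in x ∷ A , B , cong (x ∷_) e
... | true = [] , L , cong (_∷ L) (isDom-true x eq)
  where
  isDom-true : ∀ x → isDom i x ≡ true → x ≡ dom i
  isDom-true (dom j) e with i ≟ j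
  ... | yes refl = refl

lookup-middle : ∀ (A : List T) x B (u : Fin (length (A ++ x ∷ B))) → toℕ u ≡ length A → lookup (A ++ x ∷ B) u ≡ x
lookup-middle [] x B zero l = refl
lookup-middle (a ∷ A) x B (suc u) l = lookup-middle A x B u (suc-injective l)

split-at-lookup : ∀ (L : List T) (u : Fin (length L)) → Σ (List T) λ A → Σ (List T) λ B →
  L ≡ A ++ lookup L u ∷ B × length A ≡ toℕ u
split-at-lookup (x ∷ L) zero = [] , L , refl , refl
split-at-lookup (x ∷ L) (suc u) with split-at-lookup L u
... | A , B , e , l = x ∷ A , B , cong (x ∷_) e , cong suc l

All-lookup-index : ∀ {P : T → Set} (L : List T) → All P L → (u : Fin (length L)) → P (lookup L u)
All-lookup-index (x ∷ L) (p ∷ ps) zero = p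
All-lookup-index (x ∷ L) (p ∷ ps) (suc u) = All-lookup-index L ps u

module SeedProfile {κ} (L : List (Status κ)) (once : ∀ i → countDom i L ≡ 1) where

  seed : ∀ i → Σ (List (Status κ)) λ A → Σ (List (Status κ)) λ B → L ≡ A ++ dom i ∷ B
  seed i = findSeed i L (≤-reflexive (sym (once i)))

  before after : Fin κ → List (Status κ)
  before i = proj₁ (seed i)
  after i = proj₁ (proj₂ (seed i))

  split : ∀ i → L ≡ before i ++ dom i ∷ after i
  split i = proj₂ (proj₂ (seed i))

  profile : Profile κ (length L)
  profile i = fromℕ< (length-prefix< L (before i) (dom i) (after i) (split i))

  toℕ-profile : ∀ i → toℕ (profile i) ≡ length (before i)
  toℕ-profile i = toℕ-fromℕ< _

  lookup-profile : ∀ i → lookup L (profile i) ≡ dom i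
  lookup-profile i = lookup-at (split i) (profile i) (toℕ-profile i)
    where
    lookup-at : ∀ {L' A x B} → L' ≡ A ++ x ∷ B → (u : Fin (length L')) → toℕ u ≡ length A → lookup L' u ≡ x
    lookup-at {A = A} {x} {B} refl = lookup-middle A x B

  distinct : Distinct profile
  distinct i j e = dom-injective (trans (sym (lookup-profile i)) (trans (cong (lookup L) e) (lookup-profile j)))
    where
    dom-injective : ∀ {i j : Fin κ} → dom i ≡ dom j → i ≡ j
    dom-injective refl = refl

  initial-profile : NeutralFree (map shape L) → ∀ u → initial profile u ≡ lookup L u
  initial-profile nf u with lookup L u in eq
  ... | free = initial-unclaimed profile u λ (j , e) → dom≢free (trans (sym (lookup-profile j)) (trans (cong (lookup L) e) eq))
    where
    dom≢free : ∀ {j} → ¬ dom j ≡ free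
    dom≢free ()
  ... | neutral = ⊥-elim (All-lookup-index L (map⁻ nf) u (cong shape eq))
  ... | dom j = initial-seed profile distinct j (toℕ-injective (trans (toℕ-profile j) at-u))
    where
    at-u : length (before j) ≡ toℕ u
    at-u with split-at-lookup L u
    ... | C , D , eC , lC = trans (seed-position-unique j (before j) (after j) C D
      (subst (λ z → countDom j z ≡ 1) (split j) (once j)) (trans (sym (split j)) (trans eC (cong (λ z → C ++ z ∷ D) eq)))) lC

  layout-profile : NeutralFree (map shape L) → layout profile ≡ L
  layout-profile nf = trans (tabulate-cong (initial-profile nf)) (tabulate-lookup L)

map-shape-at : ∀ {L C : List (Status κ)} {x D} → L ≡ C ++ x ∷ D → x ≡ free →
  map shape L ≡ map shape C ++ free° ∷ map shape D
map-shape-at {C = C} {D = D} refl refl = map-++ shape C (free ∷ D)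

admissible⇒admits : ∀ {κ t} (L : List (Status κ)) → (∀ i → countDom i L ≡ 1) → NeutralFree (map shape L) →
  Admissible t (map shape L) → Admits (length L) κ t
admissible⇒admits {κ} {t} L once nf (admissible entrant≤ ≤seed no-deviation) = profile , nash , fin≤fin ν≤t , t≤μ
  where
  open SeedProfile L once
  G = pathGraph (length L)
  seed-layout : ∀ i → layout profile ≡ before i ++ dom i ∷ after i
  seed-layout i = trans (layout-profile nf) (split i)
  word-seed : ∀ i → map shape L ≡ map shape (before i) ++ dom° ∷ map shape (after i)
  word-seed i = trans (cong (map shape) (split i)) (map-++ shape (before i) (dom i ∷ after i))
  U≡payoff : ∀ i → U G profile i ≡ payoff (map shape (before i)) (map shape (after i))
  U≡payoff i = U-seed profile distinct (seed-layout i)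
  t≤μ : fin t ≤∞ μ profile
  t≤μ = ≤-minFin t (U G profile) λ i → subst (t ≤_) (sym (U≡payoff i)) (≤seed _ _ (word-seed i))
  ν≤t : ν profile ≤ t
  ν≤t = maxFin-≤ t _ entrant
    where
    entrant : ∀ v → U G (extend profile v) (fromℕ κ) ≤ t
    entrant v with tabulate-split (initial profile) v
    ... | C , D , eq , len = subst (_≤ t) (sym (U-extend-at profile distinct eq len))
      (ifFree-≤ (initial profile v) _ t λ x≡free → entrant≤ _ _ (map-shape-at (trans (sym (layout-profile nf)) eq) x≡free))
  nash : NashEq G profile
  nash i v with tabulate-split (vacate profile i) v
  ... | C , D , eqV , len = subst (_≤ U G profile i) (sym (U-update-at profile distinct (seed-layout i) eqV len))
    (ifFree-≤ (vacate profile i v) _ _ λ x≡free → subst (_ ≤_) (sym (U≡payoff i))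
      (no-deviation _ _ (word-seed i) _ _ (trans (sym (map-shape-at refl refl))
        (map-shape-at (trans (sym (vacate-layout profile distinct (seed-layout i))) eqV) x≡free))))

label : List Cell → List (Fin κ) → List (Status κ)
label [] ls = []
label (free° ∷ w) ls = free ∷ label w ls
label (neutral° ∷ w) ls = neutral ∷ label w ls
label (dom° ∷ w) [] = neutral ∷ label w []
label (dom° ∷ w) (l ∷ ls) = dom l ∷ label w ls

map-shape-label : ∀ w (ls : List (Fin κ)) → seeds w ≡ length ls → map shape (label w ls) ≡ w
map-shape-label [] ls e = refl
map-shape-label (free° ∷ w) ls e = cong (free° ∷_) (map-shape-label w ls e)
map-shape-label (neutral° ∷ w) ls e = cong (neutral° ∷_) (map-shape-label w ls e)
map-shape-label (dom° ∷ w) (l ∷ ls) e = cong (dom° ∷_) (map-shape-label w ls (suc-injective e))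

countDom-label : (i : Fin κ) → ∀ w ls → seeds w ≡ length ls → countDom i (label w ls) ≡ countDom i (map dom ls)
countDom-label i [] [] e = refl
countDom-label i (free° ∷ w) ls e = countDom-label i w ls e
countDom-label i (neutral° ∷ w) ls e = countDom-label i w ls e
countDom-label i (dom° ∷ w) (l ∷ ls) e with isDom i (dom l)
... | true = cong suc (countDom-label i w ls (suc-injective e))
... | false = countDom-label i w ls (suc-injective e)

countDom-allFin : (i : Fin κ) → countDom i (map dom (allFin κ)) ≡ 1
countDom-allFin {κ} i = trans (cong (countDom i) (map-tabulate (λ u → u) dom)) (countDom-tabulate-once i dom i (λ u → refl))

admitsWord⇒admits : ∀ {n κ t} → AdmitsWord n κ t → Admits n κ t
admitsWord⇒admits {n} {κ} {t} (w , len , nf , seeds≡κ , adm) =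
  subst (λ m → Admits m κ t) length-L (admissible⇒admits L once (subst NeutralFree (sym shape-L) nf) (subst (Admissible t) (sym shape-L) adm))
  where
  enough : seeds w ≡ length (allFin κ)
  enough = trans seeds≡κ (sym (length-tabulate (λ u → u)))
  L = label w (allFin κ)
  shape-L : map shape L ≡ w
  shape-L = map-shape-label w (allFin κ) enough
  length-L : length L ≡ n
  length-L = trans (sym (length-map shape L)) (trans (cong length shape-L) len)
  once : ∀ i → countDom i L ≡ 1
  once i = trans (countDom-label i w (allFin κ) enough) (countDom-allFin i)

-- Words as gap lengths

gap : ℕ → List Cell
gap k = replicate k free°

seededGaps : List ℕ → List Cell
seededGaps [] = []
seededGaps (r ∷ rs) = dom° ∷ (gap r ++ seededGaps rs)

gapsSeeded : List ℕ → List Cell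
gapsSeeded [] = []
gapsSeeded (r ∷ rs) = gap r ++ dom° ∷ gapsSeeded rs

-- The word of κ seeds separated by gaps of r₀, …, r_κ free vertices.
fromRuns : List ℕ → List Cell
fromRuns [] = []
fromRuns (r ∷ rs) = gap r ++ seededGaps rs

-- A flag tells whether a gap ends at the path end (true) or at another seed (false).
shareᵇ : Bool → ℕ → ℕ
shareᵇ true x = x
shareᵇ false x = ⌊ x /2⌋

endCell : Bool → Cell
endCell true = free°
endCell false = dom°

entryValueᵇ : Bool → Bool → ℕ → ℕ
entryValueᵇ false false r = ⌊ suc r /2⌋
entryValueᵇ false true r = r
entryValueᵇ true rb r = r

payoffᵇ : Bool → ℕ → ℕ → Bool → ℕ
payoffᵇ lb a b rb = shareᵇ lb a + suc (shareᵇ rb b)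

-- The seed between gaps a and b earns at least t, and leaving it for the merged gap does not pay.
SeedOK : ℕ → Bool → ℕ → ℕ → Bool → Set
SeedOK t lb a b rb = t ≤ payoffᵇ lb a b rb × entryValueᵇ lb rb (a + suc b) ≤ payoffᵇ lb a b rb

SeedsOK : ℕ → Bool → List ℕ → Set
SeedsOK t lb (a ∷ b ∷ rs) = SeedOK t lb a b (null rs) × SeedsOK t false (b ∷ rs)
SeedsOK t lb _ = ⊤

maxEntryRuns : Bool → List ℕ → ℕ
maxEntryRuns lb [] = 0
maxEntryRuns lb (r ∷ []) = entryValueᵇ lb true r
maxEntryRuns lb (r ∷ r' ∷ rs) = entryValueᵇ lb false r ⊔ maxEntryRuns false (r' ∷ rs)

leftGap-gap : ∀ l a k X → leftGap l a (gap k ++ X) ≡ leftGap l (k + a) X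
leftGap-gap l a zero X = refl
leftGap-gap l a (suc k) X rewrite leftGap-gap l (suc a) k X | +-suc k a = refl

leftGap-gap-end : ∀ l a k → leftGap l a (gap k) ≡ (l , k + a)
leftGap-gap-end l a zero = refl
leftGap-gap-end l a (suc k) rewrite leftGap-gap-end l (suc a) k | +-suc k a = refl

leftGap-gapsSeeded-∷ : ∀ p P l a k → leftGap l a (gapsSeeded (p ∷ P) ++ gap k) ≡ (dom° , k)
leftGap-gapsSeeded-∷ p P l a k rewrite ++-assoc (gap p) (dom° ∷ gapsSeeded P) (gap k) | leftGap-gap l a p (dom° ∷ (gapsSeeded P ++ gap k)) = go P
  where
  go : ∀ P → leftGap dom° 0 (gapsSeeded P ++ gap k) ≡ (dom° , k)
  go [] rewrite leftGap-gap-end dom° 0 k | +-identityʳ k = refl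
  go (q ∷ P) = leftGap-gapsSeeded-∷ q P dom° 0 k

leftGap-gapsSeeded : ∀ P k → leftGap free° 0 (gapsSeeded P ++ gap k) ≡ (endCell (null P) , k)
leftGap-gapsSeeded [] k rewrite leftGap-gap-end free° 0 k | +-identityʳ k = refl
leftGap-gapsSeeded (p ∷ P) k = leftGap-gapsSeeded-∷ p P free° 0 k

rightGap-seededGaps : ∀ k rest → rightGap (gap k ++ seededGaps rest) free° ≡ (k , endCell (null rest))
rightGap-seededGaps zero [] = refl
rightGap-seededGaps zero (r ∷ rest) = refl
rightGap-seededGaps (suc k) rest rewrite rightGap-seededGaps k rest = refl

share-endCell : ∀ b x → share (endCell b) x ≡ shareᵇ b x
share-endCell true x = refl
share-endCell false x = refl

entryValue-endCell : ∀ b c x → entryValue (endCell b) x (endCell c) ≡ entryValueᵇ b c x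
entryValue-endCell true c x = refl
entryValue-endCell false true x = refl
entryValue-endCell false false x = refl

payoff-runs : ∀ P o m rest →
  payoff (gapsSeeded P ++ gap o) (gap m ++ seededGaps rest) ≡ shareᵇ (null P) o + suc (shareᵇ (null rest) m)
payoff-runs P o m rest rewrite leftGap-gapsSeeded P o | rightGap-seededGaps m rest | share-endCell (null P) o | share-endCell (null rest) m = refl

vacatedEntry-runs : ∀ P a b rest →
  vacatedEntry (gapsSeeded P ++ gap a) (gap b ++ seededGaps rest) ≡ entryValueᵇ (null P) (null rest) (a + suc b)
vacatedEntry-runs P a b rest rewrite leftGap-gapsSeeded P a | rightGap-seededGaps b rest = entryValue-endCell (null P) (null rest) (a + suc b)

seededGaps-++ : ∀ P r rest → seededGaps (P ++ r ∷ rest) ≡ dom° ∷ (gapsSeeded P ++ (gap r ++ seededGaps rest))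
seededGaps-++ [] r rest = refl
seededGaps-++ (q ∷ P) r rest rewrite seededGaps-++ P r rest | ++-assoc (gap q) (dom° ∷ gapsSeeded P) (gap r ++ seededGaps rest) = refl

fromRuns-++ : ∀ P r rest → fromRuns (P ++ r ∷ rest) ≡ gapsSeeded P ++ (gap r ++ seededGaps rest)
fromRuns-++ [] r rest = refl
fromRuns-++ (p ∷ P) r rest rewrite seededGaps-++ P r rest | ++-assoc (gap p) (dom° ∷ gapsSeeded P) (gap r ++ seededGaps rest) = refl

gap-split : ∀ o m (X : List Cell) → gap (o + suc m) ++ X ≡ gap o ++ free° ∷ (gap m ++ X)
gap-split zero m X = refl
gap-split (suc o) m X = cong (free° ∷_) (gap-split o m X)

gapsSeeded-gap-split : ∀ P o m X →
  gapsSeeded P ++ (gap (o + suc m) ++ X) ≡ (gapsSeeded P ++ gap o) ++ free° ∷ (gap m ++ X)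
gapsSeeded-gap-split P o m X rewrite gap-split o m X = sym (++-assoc (gapsSeeded P) (gap o) (free° ∷ (gap m ++ X)))

gapsSeeded-seed-split : ∀ P a b rest →
  gapsSeeded P ++ (gap a ++ seededGaps (b ∷ rest)) ≡ (gapsSeeded P ++ gap a) ++ dom° ∷ (gap b ++ seededGaps rest)
gapsSeeded-seed-split P a b rest = sym (++-assoc (gapsSeeded P) (gap a) (dom° ∷ (gap b ++ seededGaps rest)))

gap-prefix-seed : ∀ r (X A B : List Cell) → gap r ++ X ≡ A ++ dom° ∷ B → Σ (List Cell) λ A' →
  A ≡ gap r ++ A' × X ≡ A' ++ dom° ∷ B
gap-prefix-seed zero X A B e = A , refl , e
gap-prefix-seed (suc r) X [] B e with ∷-injective e
... | () , _
gap-prefix-seed (suc r) X (a ∷ A) B e with ∷-injective e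
... | refl , e2 with gap-prefix-seed r X A B e2
...   | A' , f1 , f2 = A' , cong (free° ∷_) f1 , f2

fromRuns-seed-split : ∀ r rest (A B : List Cell) → gap r ++ seededGaps rest ≡ A ++ dom° ∷ B →
  Σ (List ℕ) λ P → Σ ℕ λ a → Σ ℕ λ b → Σ (List ℕ) λ rest' →
  (r ∷ rest ≡ P ++ a ∷ b ∷ rest') × A ≡ gapsSeeded P ++ gap a × B ≡ gap b ++ seededGaps rest'
fromRuns-seed-split r rest A B e with gap-prefix-seed r (seededGaps rest) A B e
fromRuns-seed-split r [] A B e | A' , f1 , f2 = ⊥-elim (nn A' f2)
  where nn : ∀ A' → ¬ [] ≡ A' ++ dom° ∷ B
        nn [] ()
        nn (_ ∷ _) ()
fromRuns-seed-split r (r' ∷ rest) A B e | [] , f1 , f2 with ∷-injective f2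
... | _ , f3 = [] , r , r' , rest , refl , trans f1 (++-identityʳ (gap r)) , sym f3
fromRuns-seed-split r (r' ∷ rest) A B e | free° ∷ A'' , f1 , f2 with ∷-injective f2
... | () , _
fromRuns-seed-split r (r' ∷ rest) A B e | neutral° ∷ A'' , f1 , f2 with ∷-injective f2
... | () , _
fromRuns-seed-split r (r' ∷ rest) A B e | dom° ∷ A'' , f1 , f2 with ∷-injective f2
... | _ , f3 with fromRuns-seed-split r' rest A'' B f3
...   | P , a , b , rest' , g1 , g2 , g3 =
  r ∷ P , a , b , rest' , cong (r ∷_) g1 ,
  trans f1 (trans (cong (λ z → gap r ++ dom° ∷ z) g2) (sym (++-assoc (gap r) (dom° ∷ gapsSeeded P) (gap a)))) , g3

maxEntry-gap : ∀ l a r X → maxEntry l a (gap r ++ X) ≡ maxEntry l (r + a) X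
maxEntry-gap l a zero X = refl
maxEntry-gap l a (suc r) X rewrite maxEntry-gap l (suc a) r X | +-suc r a = refl

maxEntry-seededGaps : ∀ lb c rs → maxEntry (endCell lb) c (seededGaps rs) ≡ maxEntryRuns lb (c ∷ rs)
maxEntry-seededGaps lb c [] = entryValue-endCell lb true c
maxEntry-seededGaps lb c (r' ∷ rs) rewrite maxEntry-gap dom° 0 r' (seededGaps rs) | +-identityʳ r' | entryValue-endCell lb false c
  = cong (entryValueᵇ lb false c ⊔_) (maxEntry-seededGaps false r' rs)

maxEntry-fromRuns : ∀ r rs → maxEntry free° 0 (fromRuns (r ∷ rs)) ≡ maxEntryRuns true (r ∷ rs)
maxEntry-fromRuns r rs rewrite maxEntry-gap free° 0 r (seededGaps rs) | +-identityʳ r = maxEntry-seededGaps true r rs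

SeedsOK-at : ∀ t lb P a b rest → SeedsOK t lb (P ++ a ∷ b ∷ rest) → SeedOK t (null P ∧ lb) a b (null rest)
SeedsOK-at t lb [] a b rest h = proj₁ h
SeedsOK-at t lb (p ∷ []) a b rest h = proj₁ (proj₂ h)
SeedsOK-at t lb (p ∷ q ∷ P) a b rest h = SeedsOK-at t false (q ∷ P) a b rest (proj₂ h)

seeds-in-runs : ∀ t r rs → SeedsOK t true (r ∷ rs) → ∀ A B → fromRuns (r ∷ rs) ≡ A ++ dom° ∷ B →
  t ≤ payoff A B × vacatedEntry A B ≤ payoff A B
seeds-in-runs t r rs ok A B e with fromRuns-seed-split r rs A B e
... | P , a , b , rest , eq , refl , refl
  with subst (λ z → SeedOK t z a b (null rest)) (∧-identityʳ (null P)) (SeedsOK-at t true P a b rest (subst (SeedsOK t true) eq ok))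
... | t≤ , vacated≤ = subst (t ≤_) (sym (payoff-runs P a b rest)) t≤ ,
  subst₂ _≤_ (sym (vacatedEntry-runs P a b rest)) (sym (payoff-runs P a b rest)) vacated≤

runsOK⇒admissible : ∀ t r rs → maxEntryRuns true (r ∷ rs) ≤ t → SeedsOK t true (r ∷ rs) →
  Admissible t (fromRuns (r ∷ rs))
runsOK⇒admissible t r rs max≤t ok =
  admissible entrant≤ (λ A B e → proj₁ (seeds-in-runs t r rs ok A B e)) no-deviation
  where
  entries≤t : ∀ {w} → fromRuns (r ∷ rs) ≡ w → maxEntry free° 0 w ≤ t
  entries≤t refl = subst (_≤ t) (sym (maxEntry-fromRuns r rs)) max≤t
  entrant≤ : ∀ A B → fromRuns (r ∷ rs) ≡ A ++ free° ∷ B → payoff A B ≤ t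
  entrant≤ A B e = ≤-trans (payoff≤maxEntry A B) (entries≤t e)
  no-deviation : ∀ A B → fromRuns (r ∷ rs) ≡ A ++ dom° ∷ B → ∀ C E → A ++ free° ∷ B ≡ C ++ free° ∷ E → payoff C E ≤ payoff A B
  no-deviation A B e C E e′ with seeds-in-runs t r rs ok A B e
  ... | t≤payoff , vacated≤payoff = begin
      payoff C E                                            ≤⟨ payoff≤maxEntry C E ⟩
      maxEntry free° 0 (C ++ free° ∷ E)                     ≡⟨ cong (maxEntry free° 0) (sym e′) ⟩
      maxEntry free° 0 (A ++ free° ∷ B)                     ≤⟨ maxEntry-vacate A B ⟩
      maxEntry free° 0 (A ++ dom° ∷ B) ⊔ vacatedEntry A B   ≤⟨ ⊔-lub (≤-trans (entries≤t e) t≤payoff) vacated≤payoff ⟩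
      payoff A B                                            ∎
    where open ≤-Reasoning

maxEntryRuns-≤ : ∀ t lb R → (∀ P r rest → R ≡ P ++ r ∷ rest → entryValueᵇ (null P ∧ lb) (null rest) r ≤ t) →
  maxEntryRuns lb R ≤ t
maxEntryRuns-≤ t lb [] h = z≤n
maxEntryRuns-≤ t lb (r ∷ []) h = h [] r [] refl
maxEntryRuns-≤ t lb (r ∷ r' ∷ rs) h = ⊔-lub (h [] r (r' ∷ rs) refl)
  (maxEntryRuns-≤ t false (r' ∷ rs) (λ P r'' rest e → subst (λ z → entryValueᵇ z (null rest) r'' ≤ t) (sym (∧-zeroʳ (null P))) (h (r ∷ P) r'' rest (cong (r ∷_) e))))

SeedsOK-intro : ∀ t lb R → (∀ P a b rest → R ≡ P ++ a ∷ b ∷ rest → SeedOK t (null P ∧ lb) a b (null rest)) →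
  SeedsOK t lb R
SeedsOK-intro t lb [] h = tt
SeedsOK-intro t lb (r ∷ []) h = tt
SeedsOK-intro t lb (a ∷ b ∷ rs) h = h [] a b rs refl ,
  SeedsOK-intro t false (b ∷ rs) (λ P a' b' rest e → subst (λ z → SeedOK t z a' b' (null rest)) (sym (∧-zeroʳ (null P))) (h (a ∷ P) a' b' rest (cong (a ∷_) e)))

entryValueᵇ-0 : ∀ x y → entryValueᵇ x y 0 ≡ 0
entryValueᵇ-0 false false = refl
entryValueᵇ-0 false true = refl
entryValueᵇ-0 true y = refl

best-entry : ∀ P r rest → Σ (List Cell) λ C → Σ (List Cell) λ E →
  gapsSeeded P ++ (gap (suc r) ++ seededGaps rest) ≡ C ++ free° ∷ E × payoff C E ≡ entryValueᵇ (null P) (null rest) (suc r)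
best-entry [] r rest = gap r , gap 0 ++ seededGaps rest ,
  trans (cong (λ k → gap k ++ seededGaps rest) (+-comm 1 r)) (gap-split r 0 (seededGaps rest)) ,
  trans (payoff-runs [] r 0 rest) (trans (cong (λ m → r + suc m) (shareᵇ-0 (null rest))) (+-comm r 1))
  where
  shareᵇ-0 : ∀ x → shareᵇ x 0 ≡ 0
  shareᵇ-0 true = refl
  shareᵇ-0 false = refl
best-entry (p ∷ P) r rest = gapsSeeded (p ∷ P) ++ gap 0 , gap r ++ seededGaps rest ,
  gapsSeeded-gap-split (p ∷ P) 0 r (seededGaps rest) , trans (payoff-runs (p ∷ P) 0 r rest) (next-to-seed (null rest))
  where
  next-to-seed : ∀ y → suc (shareᵇ y r) ≡ entryValueᵇ false y (suc r)
  next-to-seed true = refl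
  next-to-seed false = refl

entries-in-runs : ∀ t R → (∀ C E → fromRuns R ≡ C ++ free° ∷ E → payoff C E ≤ t) →
  ∀ P r rest → R ≡ P ++ r ∷ rest → entryValueᵇ (null P ∧ true) (null rest) r ≤ t
entries-in-runs t R entrant≤ P zero rest e rewrite entryValueᵇ-0 (null P ∧ true) (null rest) = z≤n
entries-in-runs t R entrant≤ P (suc r) rest e with best-entry P r rest
... | C , E , eq , value rewrite ∧-identityʳ (null P) =
  subst (_≤ t) value (entrant≤ C E (trans (cong fromRuns e) (trans (fromRuns-++ P (suc r) rest) eq)))

seeds-in-runs⁻ : ∀ t R → Admissible t (fromRuns R) →
  ∀ P a b rest → R ≡ P ++ a ∷ b ∷ rest → SeedOK t (null P ∧ true) a b (null rest)
seeds-in-runs⁻ t R (admissible _ ≤seed no-deviation) P a b rest e rewrite ∧-identityʳ (null P) = t≤payoff , vacated≤payoff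
  where
  A = gapsSeeded P ++ gap a
  B = gap b ++ seededGaps rest
  seed : fromRuns R ≡ A ++ dom° ∷ B
  seed = trans (cong fromRuns e) (trans (fromRuns-++ P a (b ∷ rest)) (gapsSeeded-seed-split P a b rest))
  t≤payoff : t ≤ payoffᵇ (null P) a b (null rest)
  t≤payoff = subst (t ≤_) (payoff-runs P a b rest) (≤seed A B seed)
  vacated≤payoff : entryValueᵇ (null P) (null rest) (a + suc b) ≤ payoffᵇ (null P) a b (null rest)
  vacated≤payoff with best-entry P (a + b) rest
  ... | C , E , eq , value = subst₂ _≤_ (trans value (cong (entryValueᵇ (null P) (null rest)) (sym (+-suc a b))))
    (payoff-runs P a b rest)
    (no-deviation A B seed C E (trans (sym (gapsSeeded-gap-split P a b (seededGaps rest)))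
      (trans (cong (λ k → gapsSeeded P ++ (gap k ++ seededGaps rest)) (+-suc a b)) eq)))

admissible⇒runsOK : ∀ t R → Admissible t (fromRuns R) → maxEntryRuns true R ≤ t × SeedsOK t true R
admissible⇒runsOK t R adm@(admissible entrant≤ _ _) =
  maxEntryRuns-≤ t true R (entries-in-runs t R entrant≤) , SeedsOK-intro t true R (seeds-in-runs⁻ t R adm)

runsOf : List Cell → ℕ × List ℕ
runsOf [] = 0 , []
runsOf (free° ∷ w) = suc (proj₁ (runsOf w)) , proj₂ (runsOf w)
runsOf (dom° ∷ w) = 0 , (proj₁ (runsOf w) ∷ proj₂ (runsOf w))
runsOf (neutral° ∷ w) = 0 , []

runs : List Cell → List ℕ
runs w = proj₁ (runsOf w) ∷ proj₂ (runsOf w)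

fromRuns-runs : ∀ w → NeutralFree w → fromRuns (runs w) ≡ w × length (proj₂ (runsOf w)) ≡ seeds w
fromRuns-runs [] nn = refl , refl
fromRuns-runs (free° ∷ w) (_ ∷ nn) with fromRuns-runs w nn
... | e1 , e2 = cong (free° ∷_) e1 , e2
fromRuns-runs (dom° ∷ w) (_ ∷ nn) with fromRuns-runs w nn
... | e1 , e2 = cong (dom° ∷_) e1 , cong suc e2
fromRuns-runs (neutral° ∷ w) (p ∷ nn) = ⊥-elim (p refl)

length-gap : ∀ r (X : List Cell) → length (gap r ++ X) ≡ r + length X
length-gap zero X = refl
length-gap (suc r) X = cong suc (length-gap r X)

length-seededGaps : ∀ rs → length (seededGaps rs) ≡ length rs + sum rs
length-seededGaps [] = refl
length-seededGaps (r ∷ rs) rewrite length-gap r (seededGaps rs) | length-seededGaps rs =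
  cong suc (solve 3 (λ a b c → a :+ (b :+ c) := b :+ (a :+ c)) refl r (length rs) (sum rs))

length-fromRuns : ∀ r rs → length (fromRuns (r ∷ rs)) ≡ length rs + sum (r ∷ rs)
length-fromRuns r rs rewrite length-gap r (seededGaps rs) | length-seededGaps rs =
  solve 3 (λ a b c → a :+ (b :+ c) := b :+ (a :+ c)) refl r (length rs) (sum rs)

seeds-gap : ∀ r (X : List Cell) → seeds (gap r ++ X) ≡ seeds X
seeds-gap zero X = refl
seeds-gap (suc r) X = seeds-gap r X

seeds-seededGaps : ∀ rs → seeds (seededGaps rs) ≡ length rs
seeds-seededGaps [] = refl
seeds-seededGaps (r ∷ rs) = cong suc (trans (seeds-gap r (seededGaps rs)) (seeds-seededGaps rs))

NeutralFree-gap : ∀ r → NeutralFree (gap r)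
NeutralFree-gap zero = []
NeutralFree-gap (suc r) = (λ ()) ∷ NeutralFree-gap r

NeutralFree-seededGaps : ∀ rs → NeutralFree (seededGaps rs)
NeutralFree-seededGaps [] = []
NeutralFree-seededGaps (r ∷ rs) = (λ ()) ∷ ++⁺ (NeutralFree-gap r) (NeutralFree-seededGaps rs)

AdmitsRuns : ℕ → ℕ → ℕ → Set
AdmitsRuns n κ t = Σ (List ℕ) λ R → length R ≡ suc κ × κ + sum R ≡ n × maxEntryRuns true R ≤ t × SeedsOK t true R

admitsWord⇒admitsRuns : ∀ {n κ t} → AdmitsWord n κ t → AdmitsRuns n κ t
admitsWord⇒admitsRuns {n} {κ} {t} (w , len , non , cnt , good) with fromRuns-runs w non
... | e1 , e2 = runs w , cong suc (trans e2 cnt) , sm , admissible⇒runsOK t (runs w) (subst (Admissible t) (sym e1) good)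
  where
  sm : κ + sum (runs w) ≡ n
  sm = trans (cong (_+ sum (runs w)) (sym (trans e2 cnt)))
         (trans (sym (length-fromRuns (proj₁ (runsOf w)) (proj₂ (runsOf w)))) (trans (cong length e1) len))

admitsRuns⇒admitsWord : ∀ {n κ t} → AdmitsRuns n κ t → AdmitsWord n κ t
admitsRuns⇒admitsWord {n} {κ} {t} ((r ∷ rs) , len , sm , rm , pl) =
  fromRuns (r ∷ rs) , trans (length-fromRuns r rs) (trans (cong (_+ sum (r ∷ rs)) lrs) sm) ,
  ++⁺ (NeutralFree-gap r) (NeutralFree-seededGaps rs) , trans (trans (seeds-gap r (seededGaps rs)) (seeds-seededGaps rs)) lrs , runsOK⇒admissible t r rs rm pl
  where
  lrs : length rs ≡ κ
  lrs = suc-injective len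

≤⌊/2⌋⇒≡0 : ∀ b → b ≤ ⌊ b /2⌋ → b ≡ 0
≤⌊/2⌋⇒≡0 zero p = refl
≤⌊/2⌋⇒≡0 (suc b) p = ⊥-elim (<⇒≱ (⌊n/2⌋<n b) p)

⌊1+n+n/2⌋≡n : ∀ t → ⌊ suc (t + t) /2⌋ ≡ t
⌊1+n+n/2⌋≡n zero = refl
⌊1+n+n/2⌋≡n (suc t) rewrite +-suc t t = cong suc (⌊1+n+n/2⌋≡n t)

⌈/2⌉-≤ : ∀ m t → m ≤ t + t → ⌈ m /2⌉ ≤ t
⌈/2⌉-≤ m t p = subst (⌈ m /2⌉ ≤_) (⌊1+n+n/2⌋≡n t) (⌈n/2⌉-mono p)

≤⌊/2⌋ : ∀ c m → c + c ≤ m → c ≤ ⌊ m /2⌋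
≤⌊/2⌋ c m p = subst (_≤ ⌊ m /2⌋) (sym (n≡⌊n+n/2⌋ c)) (⌊n/2⌋-mono p)

⊔-≤⁻ : ∀ {a b t} → a ⊔ b ≤ t → a ≤ t × b ≤ t
⊔-≤⁻ {a} {b} p = m⊔n≤o⇒m≤o a b p , m⊔n≤o⇒n≤o a b p

-- A seed next to an end gap would leave for the merged gap unless its other gap is empty.
openˡ⇒emptyʳ : ∀ {t a b} → SeedOK t true a b false → b ≡ 0
openˡ⇒emptyʳ {a = a} {b} (_ , merged≤) = ≤⌊/2⌋⇒≡0 b (≤-pred (+-cancelˡ-≤ a _ _ merged≤))

openʳ⇒emptyˡ : ∀ {t a b} → SeedOK t false a b true → a ≡ 0
openʳ⇒emptyˡ {a = a} {b} (_ , merged≤) = ≤⌊/2⌋⇒≡0 a (+-cancelʳ-≤ (suc b) _ _ merged≤)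

-- At most three players

runs-0 : ∀ n t → AdmitsRuns n 0 t ⇔ n ≤ t
runs-0 n t = mk⇔ bound (λ n≤t → (n ∷ []) , refl , +-identityʳ n , n≤t , tt)
  where
  bound : AdmitsRuns n 0 t → n ≤ t
  bound ((r ∷ []) , _ , sum≡ , max≤ , _) = subst (_≤ t) (trans (sym (+-identityʳ r)) sum≡) max≤

runs-1-intro : ∀ n t → 1 ≤ n → t ≤ n × n ≤ 2 * t + 1 → AdmitsRuns n 1 t
runs-1-intro (suc m) t _ (t≤n , n≤) = (⌊ m /2⌋ ∷ ⌈ m /2⌉ ∷ []) , refl , sum≡ , max≤ , (t≤payoff , ≤-refl) , tt
  where
  halves : ⌊ m /2⌋ + ⌈ m /2⌉ ≡ m
  halves = ⌊n/2⌋+⌈n/2⌉≡n m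
  sum≡ : 1 + (⌊ m /2⌋ + (⌈ m /2⌉ + 0)) ≡ suc m
  sum≡ = cong suc (trans (cong (⌊ m /2⌋ +_) (+-identityʳ _)) halves)
  ⌈m/2⌉≤t : ⌈ m /2⌉ ≤ t
  ⌈m/2⌉≤t = ⌈/2⌉-≤ m t (≤-pred (subst (suc m ≤_) (solve 1 (λ t → con 2 :* t :+ con 1 := con 1 :+ (t :+ t)) refl t) n≤))
  max≤ : ⌊ m /2⌋ ⊔ ⌈ m /2⌉ ≤ t
  max≤ = ⊔-lub (≤-trans (⌊n/2⌋≤⌈n/2⌉ m) ⌈m/2⌉≤t) ⌈m/2⌉≤t
  t≤payoff : t ≤ ⌊ m /2⌋ + suc ⌈ m /2⌉
  t≤payoff = subst (t ≤_) (trans (cong suc (sym halves)) (sym (+-suc _ _))) t≤n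

runs-1 : ∀ n t → 1 ≤ n → AdmitsRuns n 1 t ⇔ (t ≤ n × n ≤ 2 * t + 1)
runs-1 n t 1≤n = mk⇔ bounds (runs-1-intro n t 1≤n)
  where
  bounds : AdmitsRuns n 1 t → t ≤ n × n ≤ 2 * t + 1
  bounds ((a ∷ b ∷ []) , _ , sum≡ , max≤ , (t≤payoff , _) , _) = subst (t ≤_) n≡ t≤payoff , subst (_≤ 2 * t + 1) n≡ upper
    where
    n≡ : a + suc b ≡ n
    n≡ = trans (trans (+-suc a b) (cong (λ z → suc (a + z)) (sym (+-identityʳ b)))) sum≡
    upper : a + suc b ≤ 2 * t + 1
    upper = subst (a + suc b ≤_) (solve 1 (λ t → t :+ (con 1 :+ t) := con 2 :* t :+ con 1) refl t)
      (+-mono-≤ (proj₁ (⊔-≤⁻ max≤)) (s≤s (proj₂ (⊔-≤⁻ max≤))))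

runs-2-intro : ∀ n t → 1 ≤ t → 2 * t ≤ n × n ≤ 2 * t + 2 → AdmitsRuns n 2 t
runs-2-intro n (suc c) _ (2t≤n , n≤) =
  (⌊ m /2⌋ ∷ 0 ∷ ⌈ m /2⌉ ∷ []) , refl , sum≡ , max≤ , (t≤payoff , ≤-refl) , (s≤s (≤-trans c≤⌊m/2⌋ (⌊n/2⌋≤⌈n/2⌉ m)) , ≤-refl) , tt
  where
  m = n ∸ 2
  n≡ : n ≡ 2 + m
  n≡ = sym (m+[n∸m]≡n (≤-trans (subst (2 ≤_) (solve 1 (λ c → con 2 :+ (c :+ c) := con 2 :* (con 1 :+ c)) refl c) (m≤m+n 2 (c + c))) 2t≤n))
  sum≡ : 2 + (⌊ m /2⌋ + (0 + (⌈ m /2⌉ + 0))) ≡ n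
  sum≡ = trans (cong (λ z → 2 + (⌊ m /2⌋ + z)) (+-identityʳ _)) (trans (cong (2 +_) (⌊n/2⌋+⌈n/2⌉≡n m)) (sym n≡))
  c≤⌊m/2⌋ : c ≤ ⌊ m /2⌋
  c≤⌊m/2⌋ = ≤⌊/2⌋ c m (+-cancelˡ-≤ 2 _ _ (subst₂ _≤_ (solve 1 (λ c → con 2 :* (con 1 :+ c) := con 2 :+ (c :+ c)) refl c) n≡ 2t≤n))
  ⌈m/2⌉≤t : ⌈ m /2⌉ ≤ suc c
  ⌈m/2⌉≤t = ⌈/2⌉-≤ m (suc c) (+-cancelˡ-≤ 2 _ _
    (subst₂ _≤_ n≡ (solve 1 (λ c → con 2 :* (con 1 :+ c) :+ con 2 := con 2 :+ ((con 1 :+ c) :+ (con 1 :+ c))) refl c) n≤))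
  max≤ : ⌊ m /2⌋ ⊔ (0 ⊔ ⌈ m /2⌉) ≤ suc c
  max≤ = ⊔-lub (≤-trans (⌊n/2⌋≤⌈n/2⌉ m) ⌈m/2⌉≤t) (⊔-lub z≤n ⌈m/2⌉≤t)
  t≤payoff : suc c ≤ ⌊ m /2⌋ + suc 0
  t≤payoff = subst (suc c ≤_) (sym (trans (+-suc _ 0) (cong suc (+-identityʳ _)))) (s≤s c≤⌊m/2⌋)

runs-2 : ∀ n t → 1 ≤ t → AdmitsRuns n 2 t ⇔ (2 * t ≤ n × n ≤ 2 * t + 2)
runs-2 n t 1≤t = mk⇔ bounds (runs-2-intro n t 1≤t)
  where
  bounds : AdmitsRuns n 2 t → 2 * t ≤ n × n ≤ 2 * t + 2
  bounds ((a ∷ b ∷ c ∷ []) , _ , sum≡ , max≤ , first-ok , (t≤c+1 , _) , _) with openˡ⇒emptyʳ first-ok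
  ... | refl = subst (2 * t ≤_) n≡ lower , subst (_≤ 2 * t + 2) n≡ upper
    where
    n≡ : suc a + suc c ≡ n
    n≡ = trans (solve 2 (λ a c → (con 1 :+ a) :+ (con 1 :+ c) := con 2 :+ (a :+ (con 0 :+ (c :+ con 0)))) refl a c) sum≡
    lower : 2 * t ≤ suc a + suc c
    lower = subst (_≤ suc a + suc c) (solve 1 (λ t → t :+ t := con 2 :* t) refl t)
      (+-mono-≤ (subst (t ≤_) (trans (+-suc a 0) (cong suc (+-identityʳ a))) (proj₁ first-ok)) t≤c+1)
    upper : suc a + suc c ≤ 2 * t + 2
    upper = subst (suc a + suc c ≤_) (solve 1 (λ t → (con 1 :+ t) :+ (con 1 :+ t) := con 2 :* t :+ con 2) refl t)
      (+-mono-≤ (s≤s (proj₁ (⊔-≤⁻ max≤))) (s≤s (proj₂ (⊔-≤⁻ (proj₂ (⊔-≤⁻ {a} max≤))))))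

runs-3-bounds : ∀ {n t} → 1 ≤ t → AdmitsRuns n 3 t → t ≡ 1 × (n ≡ 3 ⊎ n ≡ 4 ⊎ n ≡ 5)
runs-3-bounds {n} {t} 1≤t ((a ∷ b ∷ c ∷ d ∷ []) , _ , sum≡ , max≤ , first-ok , (t≤1 , _) , last-ok , _)
  with openˡ⇒emptyʳ first-ok | openʳ⇒emptyˡ last-ok
... | refl | refl = t≡1 , three-to-five a d (subst (a ≤_) t≡1 (proj₁ ends≤)) (subst (d ≤_) t≡1 (proj₂ ends≤))
  (trans (cong (λ z → 3 + (a + z)) (sym (+-identityʳ d))) sum≡)
  where
  t≡1 : t ≡ 1
  t≡1 = ≤-antisym t≤1 1≤t
  ends≤ = ⊔-≤⁻ {a} {d} max≤
  three-to-five : ∀ x y → x ≤ 1 → y ≤ 1 → 3 + (x + y) ≡ n → n ≡ 3 ⊎ n ≡ 4 ⊎ n ≡ 5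
  three-to-five zero zero _ _ e = inj₁ (sym e)
  three-to-five (suc zero) zero _ _ e = inj₂ (inj₁ (sym e))
  three-to-five zero (suc zero) _ _ e = inj₂ (inj₁ (sym e))
  three-to-five (suc zero) (suc zero) _ _ e = inj₂ (inj₂ (sym e))
  three-to-five (suc (suc _)) _ (s≤s ()) _ _
  three-to-five _ (suc (suc _)) _ (s≤s ()) _

runs-3-intro : ∀ {n t} → t ≡ 1 × (n ≡ 3 ⊎ n ≡ 4 ⊎ n ≡ 5) → AdmitsRuns n 3 t
runs-3-intro (refl , inj₁ refl) =
  (0 ∷ 0 ∷ 0 ∷ 0 ∷ []) , refl , refl , z≤n , (s≤s z≤n , s≤s z≤n) , (s≤s z≤n , s≤s z≤n) , (s≤s z≤n , s≤s z≤n) , tt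
runs-3-intro (refl , inj₂ (inj₁ refl)) =
  (1 ∷ 0 ∷ 0 ∷ 0 ∷ []) , refl , refl , s≤s z≤n , (s≤s z≤n , s≤s (s≤s z≤n)) , (s≤s z≤n , s≤s z≤n) , (s≤s z≤n , s≤s z≤n) , tt
runs-3-intro (refl , inj₂ (inj₂ refl)) =
  (1 ∷ 0 ∷ 0 ∷ 1 ∷ []) , refl , refl , s≤s z≤n , (s≤s z≤n , s≤s (s≤s z≤n)) , (s≤s z≤n , s≤s z≤n) , (s≤s z≤n , s≤s (s≤s z≤n)) , tt

-- Four or more players

split-last-two : ∀ m (xs : List ℕ) → length xs ≡ suc (suc m) →
  Σ (List ℕ) λ H → Σ ℕ λ g → Σ ℕ λ e → xs ≡ H ++ g ∷ e ∷ [] × length H ≡ m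
split-last-two zero (g ∷ e ∷ []) refl = [] , g , e , refl , refl
split-last-two (suc m) (x ∷ xs) l with split-last-two m xs (suc-injective l)
... | H , g , e , eq , lh = x ∷ H , g , e , cong (x ∷_) eq , cong suc lh

null-++-∷ : ∀ (H : List T) g e → null (H ++ g ∷ e ∷ []) ≡ false
null-++-∷ [] g e = refl
null-++-∷ (_ ∷ _) g e = refl

InnerOK : ℕ → ℕ → List ℕ → ℕ → Set
InnerOK t p [] g = SeedOK t false p g false
InnerOK t p (h ∷ H) g = SeedOK t false p h false × InnerOK t h H g

SeedsOK-inner⁻ : ∀ t p H g e → SeedsOK t false (p ∷ H ++ g ∷ e ∷ []) → InnerOK t p H g × SeedOK t false g e true
SeedsOK-inner⁻ t p [] g e (c1 , c2 , _) = c1 , c2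
SeedsOK-inner⁻ t p (h ∷ H) g e (c1 , rest) =
  (subst (SeedOK t false p h) (null-++-∷ H g e) c1 , proj₁ (SeedsOK-inner⁻ t h H g e rest)) , proj₂ (SeedsOK-inner⁻ t h H g e rest)

SeedsOK-inner : ∀ t p H g e → InnerOK t p H g → SeedOK t false g e true → SeedsOK t false (p ∷ H ++ g ∷ e ∷ [])
SeedsOK-inner t p [] g e m c = m , c , tt
SeedsOK-inner t p (h ∷ H) g e (m1 , m) c =
  subst (SeedOK t false p h) (sym (null-++-∷ H g e)) m1 , SeedsOK-inner t h H g e m c

maxEntryRuns-inner⁻ : ∀ t p H g e → maxEntryRuns false (p ∷ H ++ g ∷ e ∷ []) ≤ t →
  ⌊ suc p /2⌋ ≤ t × All (λ h → ⌊ suc h /2⌋ ≤ t) H × ⌊ suc g /2⌋ ≤ t × e ≤ t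
maxEntryRuns-inner⁻ t p [] g e r = proj₁ (⊔-≤⁻ {⌊ suc p /2⌋} r) , [] , proj₁ (⊔-≤⁻ {⌊ suc g /2⌋} (proj₂ (⊔-≤⁻ {⌊ suc p /2⌋} r))) ,
  proj₂ (⊔-≤⁻ {⌊ suc g /2⌋} (proj₂ (⊔-≤⁻ {⌊ suc p /2⌋} r)))
maxEntryRuns-inner⁻ t p (h ∷ H) g e r with maxEntryRuns-inner⁻ t h H g e (proj₂ (⊔-≤⁻ {⌊ suc p /2⌋} r))
... | a , b , c , d = proj₁ (⊔-≤⁻ {⌊ suc p /2⌋} r) , a ∷ b , c , d

maxEntryRuns-inner : ∀ t p H g e → ⌊ suc p /2⌋ ≤ t → All (λ h → ⌊ suc h /2⌋ ≤ t) H → ⌊ suc g /2⌋ ≤ t → e ≤ t →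
  maxEntryRuns false (p ∷ H ++ g ∷ e ∷ []) ≤ t
maxEntryRuns-inner t p [] g e a b c d = ⊔-lub a (⊔-lub c d)
maxEntryRuns-inner t p (h ∷ H) g e a (b ∷ bs) c d = ⊔-lub a (maxEntryRuns-inner t h H g e b bs c d)

⌊1+n/2⌋≤m⇒n≤m+m : ∀ h t → ⌊ suc h /2⌋ ≤ t → h ≤ t + t
⌊1+n/2⌋≤m⇒n≤m+m zero t p = z≤n
⌊1+n/2⌋≤m⇒n≤m+m (suc zero) t p = ≤-trans p (m≤m+n t t)
⌊1+n/2⌋≤m⇒n≤m+m (suc (suc h)) (suc t) (s≤s p) = subst (suc (suc h) ≤_) (sym (cong suc (+-suc t t))) (s≤s (s≤s (⌊1+n/2⌋≤m⇒n≤m+m h t p)))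

sum≤length* : ∀ b H → All (_≤ b) H → sum H ≤ length H * b
sum≤length* b [] [] = z≤n
sum≤length* b (h ∷ H) (p ∷ ps) = +-mono-≤ p (sum≤length* b H ps)

sumHalves : List ℕ → ℕ
sumHalves [] = 0
sumHalves (h ∷ H) = ⌊ h /2⌋ + sumHalves H

⌊n/2⌋+⌊n/2⌋≤n : ∀ h → ⌊ h /2⌋ + ⌊ h /2⌋ ≤ h
⌊n/2⌋+⌊n/2⌋≤n h = subst (⌊ h /2⌋ + ⌊ h /2⌋ ≤_) (⌊n/2⌋+⌈n/2⌉≡n h) (+-monoʳ-≤ ⌊ h /2⌋ (⌊n/2⌋≤⌈n/2⌉ h))

sumHalves+sumHalves≤sum : ∀ H → sumHalves H + sumHalves H ≤ sum H
sumHalves+sumHalves≤sum [] = z≤n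
sumHalves+sumHalves≤sum (h ∷ H) = subst (_≤ h + sum H)
  (solve 2 (λ a b → (a :+ a) :+ (b :+ b) := (a :+ b) :+ (a :+ b)) refl ⌊ h /2⌋ (sumHalves H))
  (+-mono-≤ (⌊n/2⌋+⌊n/2⌋≤n h) (sumHalves+sumHalves≤sum H))

pair-lower : ∀ c x y → suc c ≤ ⌊ x /2⌋ + suc ⌊ y /2⌋ → c ≤ ⌊ x /2⌋ + ⌊ y /2⌋
pair-lower c x y p = ≤-pred (subst (suc c ≤_) (+-suc _ _) p)

sumHalves-even : ∀ c k p H → length H ≡ k + k → InnerOK (suc c) p H 0 → k * c ≤ sumHalves H
sumHalves-even c zero p [] l m = z≤n
sumHalves-even c (suc k) p (x ∷ y ∷ H) l (m1 , m2 , m3) =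
  subst (suc k * c ≤_) (+-assoc ⌊ x /2⌋ ⌊ y /2⌋ (sumHalves H))
    (+-mono-≤ (pair-lower c x y (proj₁ m2)) (sumHalves-even c k y H (suc-injective (trans (suc-injective l) (+-suc k k))) m3))
sumHalves-even c (suc k) p [] () m
sumHalves-even c (suc k) p (x ∷ []) l m = ⊥-elim (0≢ (trans (suc-injective l) (+-suc k k)))
  where 0≢ : ¬ 0 ≡ suc (k + k)
        0≢ ()

sumHalves-odd : ∀ c k p H → length H ≡ suc (k + k) → InnerOK (suc c) p H 0 → suc k * c ≤ sumHalves H
sumHalves-odd c zero p (x ∷ []) l (m1 , m2) = +-monoˡ-≤ 0 (subst (c ≤_) (+-identityʳ _) (pair-lower c x 0 (proj₁ m2)))
sumHalves-odd c zero p (x ∷ y ∷ H) () m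
sumHalves-odd c (suc k) p (x ∷ y ∷ H) l (m1 , m2 , m3) =
  subst (suc (suc k) * c ≤_) (+-assoc ⌊ x /2⌋ ⌊ y /2⌋ (sumHalves H))
    (+-mono-≤ (pair-lower c x y (proj₁ m2)) (sumHalves-odd c k y H (suc-injective (trans (suc-injective l) (cong suc (+-suc k k)))) m3))
sumHalves-odd c (suc k) p (x ∷ []) () m

2*[4+j]∸4 : ∀ j → 2 * (4 + j) ∸ 4 ≡ 4 + 2 * j
2*[4+j]∸4 j = trans (cong (_∸ 4) (solve 1 (λ j → con 2 :* (con 4 :+ j) := con 4 :+ (con 4 :+ con 2 :* j)) refl j))
  (m+n∸m≡n 4 (4 + 2 * j))

upper-identity : ∀ j t → (4 + j) + (t + ((suc j) * (t + t) + t)) ≡ (4 + 2 * j) * t + (4 + j)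
upper-identity j t = solve 2 (λ j t → (con 4 :+ j) :+ (t :+ ((con 1 :+ j) :* (t :+ t) :+ t)) := (con 4 :+ con 2 :* j) :* t :+ (con 4 :+ j)) refl j t

threshold-even : ∀ k c → (4 + (k + k)) * suc c ≡ (4 + (k + k)) + (c + (((c + k * c) + (c + k * c)) + c))
threshold-even k c = solve 2 (λ k c → (con 4 :+ (k :+ k)) :* (con 1 :+ c) := (con 4 :+ (k :+ k)) :+ (c :+ (((c :+ k :* c) :+ (c :+ k :* c)) :+ c))) refl k c

threshold-odd : ∀ k c →
  suc (4 + suc (k + k)) * suc c ∸ 1 ≡ (4 + suc (k + k)) + (c + (((c + suc k * c) + (c + suc k * c)) + c))
threshold-odd k c = solve 2 (λ k c → c :+ (con 5 :+ (k :+ k)) :* (con 1 :+ c) := (con 5 :+ (k :+ k)) :+ (c :+ (((c :+ (c :+ k :* c)) :+ (c :+ (c :+ k :* c))) :+ c))) refl k c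

sumHalves-inner-even : ∀ c k H → length H ≡ suc (k + k) → InnerOK (suc c) 0 H 0 → c + k * c ≤ sumHalves H
sumHalves-inner-even c k (h ∷ H) l (m1 , m) = +-mono-≤ (≤-pred (proj₁ m1)) (sumHalves-even c k h H (suc-injective l) m)

sumHalves-inner-odd : ∀ c k H → length H ≡ suc (suc (k + k)) → InnerOK (suc c) 0 H 0 → c + suc k * c ≤ sumHalves H
sumHalves-inner-odd c k (h ∷ H) l (m1 , m) = +-mono-≤ (≤-pred (proj₁ m1)) (sumHalves-odd c k h H (suc-injective l) m)

record ManyPlayerRuns (n j c : ℕ) : Set where
  field
    first last : ℕ
    inner : List ℕ
    length-inner : length inner ≡ suc j
    total : n ≡ (4 + j) + (first + (sum inner + last))
    c≤first : c ≤ first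
    first≤t : first ≤ suc c
    c≤last : c ≤ last
    last≤t : last ≤ suc c
    inner≤2t : All (_≤ suc c + suc c) inner
    inner-ok : InnerOK (suc c) 0 inner 0

many-player-runs : ∀ {n j c} → AdmitsRuns n (4 + j) (suc c) → ManyPlayerRuns n j c
many-player-runs {n} {j} {c} ((e0 ∷ g1 ∷ rest) , len , sum≡ , max≤ , first-ok , rest-ok)
  with split-last-two (suc j) rest (suc-injective (suc-injective len))
... | H , g' , e , refl , lH with SeedsOK-inner⁻ (suc c) g1 H g' e rest-ok
... | inner-ok , last-ok with subst (SeedOK (suc c) true e0 g1) (null-++-∷ H g' e) first-ok
... | first-ok′ with openˡ⇒emptyʳ first-ok′ | openʳ⇒emptyˡ last-ok
... | refl | refl = record
  { first = e0 ; last = e ; inner = H ; length-inner = lH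
  ; total = trans (sym sum≡) (cong (λ x → (4 + j) + (e0 + x)) (trans (sum-++ H (0 ∷ e ∷ [])) (cong (sum H +_) (+-identityʳ e))))
  ; c≤first = ≤-pred (subst (suc c ≤_) (+-comm e0 1) (proj₁ first-ok′))
  ; first≤t = proj₁ (⊔-≤⁻ max≤)
  ; c≤last = ≤-pred (proj₁ last-ok)
  ; last≤t = proj₂ (proj₂ (proj₂ inner-max))
  ; inner≤2t = All-map (λ {h} → ⌊1+n/2⌋≤m⇒n≤m+m h (suc c)) (proj₁ (proj₂ inner-max))
  ; inner-ok = inner-ok
  }
  where
  inner-max = maxEntryRuns-inner⁻ (suc c) 0 H 0 e (proj₂ (⊔-≤⁻ {e0} max≤))

many-upper : ∀ {n j c} → ManyPlayerRuns n j c → n ≤ (2 * (4 + j) ∸ 4) * suc c + (4 + j)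
many-upper {n} {j} {c} r = begin
    n                                            ≡⟨ total ⟩
    (4 + j) + (first + (sum inner + last))       ≤⟨ +-monoʳ-≤ (4 + j) (+-mono-≤ first≤t (+-mono-≤ inner-sum last≤t)) ⟩
    (4 + j) + (t + (suc j * (t + t) + t))        ≡⟨ upper-identity j t ⟩
    (4 + 2 * j) * t + (4 + j)                    ≡⟨ cong (λ z → z * t + (4 + j)) (sym (2*[4+j]∸4 j)) ⟩
    (2 * (4 + j) ∸ 4) * t + (4 + j)              ∎
  where
  open ManyPlayerRuns r
  open ≤-Reasoning
  t = suc c
  inner-sum : sum inner ≤ suc j * (t + t)
  inner-sum = subst (λ l → sum inner ≤ l * (t + t)) length-inner (sum≤length* (t + t) inner inner≤2t)

many-lower : ∀ {n j c} (r : ManyPlayerRuns n j c) → ∀ {L} → L ≤ sumHalves (ManyPlayerRuns.inner r) →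
  (4 + j) + (c + ((L + L) + c)) ≤ n
many-lower {n} {j} {c} r {L} L≤ = subst ((4 + j) + (c + ((L + L) + c)) ≤_) (sym total)
  (+-monoʳ-≤ (4 + j) (+-mono-≤ c≤first (+-mono-≤ (≤-trans (+-mono-≤ L≤ L≤) (sumHalves+sumHalves≤sum inner)) c≤last)))
  where open ManyPlayerRuns r

many-lower-even : ∀ {n c} k → ManyPlayerRuns n (k + k) c → (4 + (k + k)) * suc c ≤ n
many-lower-even {c = c} k r = ≤-trans (≤-reflexive (threshold-even k c))
  (many-lower r (sumHalves-inner-even c k inner length-inner inner-ok))
  where open ManyPlayerRuns r

many-lower-odd : ∀ {n c} k → ManyPlayerRuns n (suc (k + k)) c → suc (4 + suc (k + k)) * suc c ∸ 1 ≤ n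
many-lower-odd {c = c} k r = ≤-trans (≤-reflexive (threshold-odd k c))
  (many-lower r (sumHalves-inner-odd c k inner length-inner inner-ok))
  where open ManyPlayerRuns r

-- Admitted runs whose inner gaps have even lengths 2h₁, …, 2h_{j+1}.
Chain : ℕ → ℕ → List ℕ → Set
Chain c p [] = c ≤ p
Chain c p (h ∷ hs) = c ≤ p + h × Chain c h hs

double : ℕ → ℕ
double h = h + h

Config : ℕ → ℕ → Set
Config c j = Σ ℕ λ e0 → Σ ℕ λ e → Σ (List ℕ) λ hs →
  (c ≤ e0 × e0 ≤ suc c) × (c ≤ e × e ≤ suc c) × All (_≤ suc c) hs × Chain c 0 hs × length hs ≡ suc j

configRuns : ∀ {c j} → Config c j → List ℕ
configRuns (e0 , e , hs , _) = e0 ∷ 0 ∷ map double hs ++ 0 ∷ e ∷ []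

configTotal : ∀ {c j} → Config c j → ℕ
configTotal (e0 , e , hs , _) = e0 + ((sum hs + sum hs) + e)

sum-map-double : ∀ hs → sum (map double hs) ≡ sum hs + sum hs
sum-map-double [] = refl
sum-map-double (h ∷ hs) rewrite sum-map-double hs = solve 2 (λ h s → (h :+ h) :+ (s :+ s) := (h :+ s) :+ (h :+ s)) refl h (sum hs)

sum-runs : ∀ {c j} (cf : Config c j) → sum (configRuns cf) ≡ configTotal cf
sum-runs (e0 , e , hs , _) rewrite sum-++ (map double hs) (0 ∷ e ∷ []) | sum-map-double hs | +-identityʳ e = refl

⌊/2⌋-double-merge : ∀ p h → ⌊ suc ((p + p) + suc (h + h)) /2⌋ ≡ suc (p + h)
⌊/2⌋-double-merge p h rewrite solve 2 (λ p h → (p :+ p) :+ (con 1 :+ (h :+ h)) := con 1 :+ ((p :+ h) :+ (p :+ h))) refl p h =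
  cong suc (sym (n≡⌊n+n/2⌋ (p + h)))

payoff-double : ∀ p h → ⌊ p + p /2⌋ + suc ⌊ h + h /2⌋ ≡ suc (p + h)
payoff-double p h rewrite sym (n≡⌊n+n/2⌋ p) | sym (n≡⌊n+n/2⌋ h) = +-suc p h

SeedOK-double : ∀ c p h → c ≤ p + h → SeedOK (suc c) false (p + p) (h + h) false
SeedOK-double c p h q = subst (suc c ≤_) (sym (payoff-double p h)) (s≤s q) ,
  subst₂ _≤_ (sym (⌊/2⌋-double-merge p h)) (sym (payoff-double p h)) ≤-refl

InnerOK-chain : ∀ c p hs → Chain c p hs → InnerOK (suc c) (double p) (map double hs) 0
InnerOK-chain c p [] q = SeedOK-double c p 0 (subst (c ≤_) (sym (+-identityʳ p)) q)
InnerOK-chain c p (h ∷ hs) (q , qs) = SeedOK-double c p h q , InnerOK-chain c h hs qs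

length-runs : ∀ {c j} (cf : Config c j) → length (configRuns cf) ≡ suc (4 + j)
length-runs (e0 , e , hs , _ , _ , _ , _ , lh) rewrite length-++ (map double hs) {0 ∷ e ∷ []} | length-map double hs | lh =
  cong (λ z → suc (suc z)) (+-comm _ 2)

config⇒admitsRuns : ∀ {c j} (cf : Config c j) → AdmitsRuns ((4 + j) + sum (configRuns cf)) (4 + j) (suc c)
config⇒admitsRuns {c} {j} cf@(e0 , e , hs , (e0g , e0l) , (eg , el) , hle , ch , lh) =
  configRuns cf , length-runs cf , refl , max≤t , seeds-ok
  where
  t = suc c
  entries-in-doubled : ∀ {hs} → All (_≤ t) hs → All (λ h → ⌊ suc h /2⌋ ≤ t) (map double hs)
  entries-in-doubled [] = []
  entries-in-doubled (p ∷ ps) = subst (_≤ t) (sym (⌊1+n+n/2⌋≡n _)) p ∷ entries-in-doubled ps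
  max≤t : maxEntryRuns true (configRuns cf) ≤ t
  max≤t = ⊔-lub e0l (maxEntryRuns-inner t 0 (map double hs) 0 e z≤n (entries-in-doubled hle) z≤n el)
  first-ok : SeedOK t true e0 0 false
  first-ok = subst (t ≤_) (sym (trans (+-suc e0 0) (cong suc (+-identityʳ e0)))) (s≤s e0g) , ≤-refl
  seeds-ok : SeedsOK t true (configRuns cf)
  seeds-ok = subst (SeedOK t true e0 0) (sym (null-++-∷ (map double hs) 0 e)) first-ok ,
       SeedsOK-inner t 0 (map double hs) 0 e (InnerOK-chain c 0 hs ch) (s≤s eg , ≤-refl)

bump : ℕ → List ℕ → List ℕ
bump t [] = []
bump t (h ∷ hs) with suc h ≤? t
... | yes _ = suc h ∷ hs
... | no _ = h ∷ bump t hs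

length-bump : ∀ t hs → length (bump t hs) ≡ length hs
length-bump t [] = refl
length-bump t (h ∷ hs) with suc h ≤? t
... | yes _ = refl
... | no _ = cong suc (length-bump t hs)

All-bump : ∀ t hs → All (_≤ t) hs → All (_≤ t) (bump t hs)
All-bump t [] [] = []
All-bump t (h ∷ hs) (p ∷ ps) with suc h ≤? t
... | yes q = q ∷ ps
... | no _ = p ∷ All-bump t hs ps

Chain-mono : ∀ c p p' hs → p ≤ p' → Chain c p hs → Chain c p' hs
Chain-mono c p p' [] le q = ≤-trans q le
Chain-mono c p p' (h ∷ hs) le (q , qs) = ≤-trans q (+-monoˡ-≤ h le) , qs

Chain-bump : ∀ t c p hs → Chain c p hs → Chain c p (bump t hs)
Chain-bump t c p [] q = q
Chain-bump t c p (h ∷ hs) (q , qs) with suc h ≤? t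
... | yes _ = ≤-trans q (+-monoʳ-≤ p (n≤1+n h)) , Chain-mono c h (suc h) hs (n≤1+n h) qs
... | no _ = q , Chain-bump t c h hs qs

sum-bump : ∀ t hs → All (_≤ t) hs → sum hs < length hs * t → sum (bump t hs) ≡ suc (sum hs)
sum-bump t [] [] ()
sum-bump t (h ∷ hs) (p ∷ ps) lt with suc h ≤? t
... | yes _ = refl
... | no nq = trans (cong (h +_) (sum-bump t hs ps lt')) (+-suc h (sum hs))
  where
  ht : h ≡ t
  ht = ≤-antisym p (≮⇒≥ nq)
  lt' : sum hs < length hs * t
  lt' = +-cancelˡ-< t _ _ (subst (λ z → z + sum hs < t + length hs * t) ht lt)

m≤n≤1+m⇒n≡m⊎n≡1+m : ∀ c e → c ≤ e → e ≤ suc c → e ≡ c ⊎ e ≡ suc c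
m≤n≤1+m⇒n≡m⊎n≡1+m c e p q with m≤n⇒m<n∨m≡n q
... | inj₂ eq = inj₂ eq
... | inj₁ lt = inj₁ (≤-antisym (≤-pred lt) p)

maxTotal : ℕ → ℕ → ℕ
maxTotal c j = suc c + ((suc j * suc c + suc j * suc c) + suc c)

-- Grow the first end gap to t, then the last one; once both have length t, shrink the
-- first back to t − 1 and grow an inner gap by two.
config-suc : ∀ {c j} (cf : Config c j) → configTotal cf < maxTotal c j → Σ (Config c j) λ cf' →
  configTotal cf' ≡ suc (configTotal cf)
config-suc {c} {j} (e0 , e , hs , (e0g , e0l) , (eg , el) , hle , ch , lh) lt with m≤n≤1+m⇒n≡m⊎n≡1+m c e0 e0g e0l | m≤n≤1+m⇒n≡m⊎n≡1+m c e eg el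
... | inj₁ refl | _ = (suc c , e , hs , (n≤1+n c , ≤-refl) , (eg , el) , hle , ch , lh) , refl
... | inj₂ refl | inj₁ refl = (suc c , suc c , hs , (n≤1+n c , ≤-refl) , (n≤1+n c , ≤-refl) , hle , ch , lh) ,
       solve 2 (λ c s → (con 1 :+ c) :+ (s :+ (con 1 :+ c)) := con 1 :+ ((con 1 :+ c) :+ (s :+ c))) refl c (sum hs + sum hs)
... | inj₂ refl | inj₂ refl =
  (c , suc c , bump (suc c) hs , (≤-refl , n≤1+n c) , (n≤1+n c , ≤-refl) , All-bump (suc c) hs hle ,
     Chain-bump (suc c) c 0 hs ch , trans (length-bump (suc c) hs) lh) , eq
  where
  S = sum hs
  M = suc j * suc c
  SM : S + S < M + M
  SM = +-cancelʳ-< (suc c) _ _ (+-cancelˡ-< (suc c) _ _ lt)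
  S<M : S < M
  S<M with S <? M
  ... | yes p = p
  ... | no np = ⊥-elim (<⇒≱ SM (+-mono-≤ (≮⇒≥ np) (≮⇒≥ np)))
  bs : sum (bump (suc c) hs) ≡ suc S
  bs = sum-bump (suc c) hs hle (subst (λ z → S < z * suc c) (sym lh) S<M)
  eq : c + ((sum (bump (suc c) hs) + sum (bump (suc c) hs)) + suc c) ≡ suc (suc c + ((S + S) + suc c))
  eq rewrite bs = solve 2 (λ c s → c :+ (((con 1 :+ s) :+ (con 1 :+ s)) :+ (con 1 :+ c)) := con 1 :+ ((con 1 :+ c) :+ ((s :+ s) :+ (con 1 :+ c)))) refl c S

config-+ : ∀ {c j} (base : Config c j) x → configTotal base + x ≤ maxTotal c j → Σ (Config c j) λ cf →
  configTotal cf ≡ configTotal base + x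
config-+ base zero le = base , sym (+-identityʳ _)
config-+ {c} {j} base (suc x) le with config-+ base x (≤-trans (+-monoʳ-≤ (configTotal base) (n≤1+n x)) le)
... | cf , e with config-suc cf (subst (_< maxTotal c j) (sym e) (subst (_≤ maxTotal c j) (+-suc (configTotal base) x) le))
...   | cf' , e' = cf' , trans e' (trans (cong suc e) (sym (+-suc (configTotal base) x)))

evenPattern : ℕ → ℕ → List ℕ
evenPattern c zero = []
evenPattern c (suc k) = 0 ∷ c ∷ evenPattern c k

oddPattern : ℕ → ℕ → List ℕ
oddPattern c zero = c ∷ []
oddPattern c (suc k) = 0 ∷ c ∷ oddPattern c k

Chain-evenPattern : ∀ c k → Chain c c (evenPattern c k)
Chain-evenPattern c zero = ≤-refl
Chain-evenPattern c (suc k) = m≤m+n c 0 , ≤-refl , Chain-evenPattern c k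

Chain-oddPattern : ∀ c k → Chain c c (oddPattern c k)
Chain-oddPattern c zero = m≤m+n c c , ≤-refl
Chain-oddPattern c (suc k) = m≤m+n c 0 , ≤-refl , Chain-oddPattern c k

All-evenPattern : ∀ c k → All (_≤ suc c) (evenPattern c k)
All-evenPattern c zero = []
All-evenPattern c (suc k) = z≤n ∷ n≤1+n c ∷ All-evenPattern c k

All-oddPattern : ∀ c k → All (_≤ suc c) (oddPattern c k)
All-oddPattern c zero = n≤1+n c ∷ []
All-oddPattern c (suc k) = z≤n ∷ n≤1+n c ∷ All-oddPattern c k

sum-evenPattern : ∀ c k → sum (evenPattern c k) ≡ k * c
sum-evenPattern c zero = refl
sum-evenPattern c (suc k) = cong (c +_) (sum-evenPattern c k)

sum-oddPattern : ∀ c k → sum (oddPattern c k) ≡ c + k * c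
sum-oddPattern c zero = refl
sum-oddPattern c (suc k) = cong (c +_) (sum-oddPattern c k)

length-evenPattern : ∀ c k → length (evenPattern c k) ≡ k + k
length-evenPattern c zero = refl
length-evenPattern c (suc k) = cong suc (trans (cong suc (length-evenPattern c k)) (sym (+-suc k k)))

length-oddPattern : ∀ c k → length (oddPattern c k) ≡ suc (k + k)
length-oddPattern c zero = refl
length-oddPattern c (suc k) = cong suc (trans (cong suc (length-oddPattern c k)) (cong suc (sym (+-suc k k))))

minConfig-even : ∀ c k → Config c (k + k)
minConfig-even c k = c , c , c ∷ evenPattern c k , (≤-refl , n≤1+n c) , (≤-refl , n≤1+n c) ,
  n≤1+n c ∷ All-evenPattern c k , (≤-refl , Chain-evenPattern c k) , cong suc (length-evenPattern c k)

minConfig-odd : ∀ c k → Config c (suc (k + k))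
minConfig-odd c k = c , c , c ∷ oddPattern c k , (≤-refl , n≤1+n c) , (≤-refl , n≤1+n c) ,
  n≤1+n c ∷ All-oddPattern c k , (≤-refl , Chain-oddPattern c k) , cong suc (length-oddPattern c k)

runs-many-intro : ∀ {c j} n (base : Config c j) → (4 + j) + configTotal base ≤ n →
  n ≤ (4 + j) + maxTotal c j → AdmitsRuns n (4 + j) (suc c)
runs-many-intro {c} {j} n base lo hi with config-+ base (n ∸ ((4 + j) + configTotal base)) le
  where
  x = n ∸ ((4 + j) + configTotal base)
  le : configTotal base + x ≤ maxTotal c j
  le = +-cancelˡ-≤ (4 + j) _ _ (subst (_≤ (4 + j) + maxTotal c j)
        (trans (sym (m+[n∸m]≡n lo)) (+-assoc (4 + j) (configTotal base) x)) hi)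
... | cf , e = subst (λ z → AdmitsRuns z (4 + j) (suc c)) eqn (config⇒admitsRuns cf)
  where
  eqn : (4 + j) + sum (configRuns cf) ≡ n
  eqn = trans (cong ((4 + j) +_) (trans (sum-runs cf) e))
    (trans (sym (+-assoc (4 + j) (configTotal base) _)) (m+[n∸m]≡n lo))

maxTotal-identity : ∀ j c → (4 + j) + maxTotal c j ≡ (2 * (4 + j) ∸ 4) * suc c + (4 + j)
maxTotal-identity j c rewrite 2*[4+j]∸4 j = solve 2 (λ j c → (con 4 :+ j) :+ ((con 1 :+ c) :+ (((con 1 :+ j) :* (con 1 :+ c) :+ (con 1 :+ j) :* (con 1 :+ c)) :+ (con 1 :+ c)))
  := (con 4 :+ con 2 :* j) :* (con 1 :+ c) :+ (con 4 :+ j)) refl j c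

runs-many-even-intro : ∀ k n c → (4 + (k + k)) * suc c ≤ n →
  n ≤ (2 * (4 + (k + k)) ∸ 4) * suc c + (4 + (k + k)) → AdmitsRuns n (4 + (k + k)) (suc c)
runs-many-even-intro k n c lo hi = runs-many-intro n (minConfig-even c k)
  (subst (_≤ n) (eqB) lo) (subst (n ≤_) (sym (maxTotal-identity (k + k) c)) hi)
  where
  eqB : (4 + (k + k)) * suc c ≡ (4 + (k + k)) + configTotal (minConfig-even c k)
  eqB rewrite sum-evenPattern c k = threshold-even k c

runs-many-odd-intro : ∀ k n c → suc (4 + suc (k + k)) * suc c ∸ 1 ≤ n →
  n ≤ (2 * (4 + suc (k + k)) ∸ 4) * suc c + (4 + suc (k + k)) → AdmitsRuns n (4 + suc (k + k)) (suc c)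
runs-many-odd-intro k n c lo hi = runs-many-intro n (minConfig-odd c k)
  (subst (_≤ n) (eqB) lo) (subst (n ≤_) (sym (maxTotal-identity (suc (k + k)) c)) hi)
  where
  eqB : suc (4 + suc (k + k)) * suc c ∸ 1 ≡ (4 + suc (k + k)) + configTotal (minConfig-odd c k)
  eqB rewrite sum-oddPattern c k = threshold-odd k c

admits⇔admitsRuns : ∀ {n κ t} → 1 ≤ t → Admits n κ t ⇔ AdmitsRuns n κ t
admits⇔admitsRuns 1≤t = mk⇔ (admitsWord⇒admitsRuns ∘ admits⇒admitsWord 1≤t) (admitsWord⇒admits ∘ admitsRuns⇒admitsWord)

parity : ∀ j → Σ ℕ λ k → j ≡ k + k ⊎ j ≡ suc (k + k)
parity zero = 0 , inj₁ refl
parity (suc j) with parity j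
... | k , inj₁ e = k , inj₂ (cong suc e)
... | k , inj₂ e = suc k , inj₁ (trans (cong suc e) (cong suc (sym (+-suc k k))))

[k+k]%2≡0 : ∀ k → (k + k) % 2 ≡ 0
[k+k]%2≡0 zero = refl
[k+k]%2≡0 (suc k) = trans (cong (_% 2) (trans (cong suc (+-suc k k)) (+-comm 2 (k + k)))) (trans ([m+n]%n≡m%n (k + k) 2) ([k+k]%2≡0 k))

[1+k+k]%2≡1 : ∀ k → suc (k + k) % 2 ≡ 1
[1+k+k]%2≡1 zero = refl
[1+k+k]%2≡1 (suc k) = trans (cong (_% 2) (trans (cong (λ z → suc (suc z)) (+-suc k k)) (+-comm 2 (suc (k + k))))) (trans ([m+n]%n≡m%n (suc (k + k)) 2) ([1+k+k]%2≡1 k))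

[4+m]%2≡m%2 : ∀ m → (4 + m) % 2 ≡ m % 2
[4+m]%2≡m%2 m = trans (cong (_% 2) (+-comm 4 m)) (trans (cong (_% 2) (sym (+-assoc m 2 2))) (trans ([m+n]%n≡m%n (m + 2) 2) ([m+n]%n≡m%n m 2)))

runs-many-even : ∀ k n c → AdmitsRuns n (4 + (k + k)) (suc c) ⇔
  ((4 + (k + k)) * suc c ≤ n × n ≤ (2 * (4 + (k + k)) ∸ 4) * suc c + (4 + (k + k)))
runs-many-even k n c = mk⇔ (λ adm → let r = many-player-runs adm in many-lower-even k r , many-upper r)
  (λ (lo , hi) → runs-many-even-intro k n c lo hi)

runs-many-odd : ∀ k n c → AdmitsRuns n (4 + suc (k + k)) (suc c) ⇔
  (suc (4 + suc (k + k)) * suc c ∸ 1 ≤ n × n ≤ (2 * (4 + suc (k + k)) ∸ 4) * suc c + (4 + suc (k + k)))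
runs-many-odd k n c = mk⇔ (λ adm → let r = many-player-runs adm in many-lower-odd k r , many-upper r)
  (λ (lo , hi) → runs-many-odd-intro k n c lo hi)

runs-many : ∀ n c κ → 4 ≤ κ →
    (κ % 2 ≡ 1 → AdmitsRuns n κ (suc c) ⇔ ((suc κ * suc c ∸ 1 ≤ n) × (n ≤ (2 * κ ∸ 4) * suc c + κ)))
  × (κ % 2 ≡ 0 → AdmitsRuns n κ (suc c) ⇔ ((κ * suc c ≤ n) × (n ≤ (2 * κ ∸ 4) * suc c + κ)))
runs-many n c (suc (suc (suc (suc j)))) (s≤s (s≤s (s≤s (s≤s z≤n)))) with parity j
... | k , inj₁ refl = (λ odd → ⊥-elim (0≢1+n (trans (sym (trans ([4+m]%2≡m%2 (k + k)) ([k+k]%2≡0 k))) odd))) ,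
  (λ _ → runs-many-even k n c)
... | k , inj₂ refl =
  (λ _ → runs-many-odd k n c) ,
  (λ even → ⊥-elim (0≢1+n (trans (sym even) (trans ([4+m]%2≡m%2 (suc (k + k))) ([1+k+k]%2≡1 k)))))

lemma7 : (n : ℕ) → 1 ≤ n → (t : ℕ) → 1 ≤ t →
    (Admits n 0 t ⇔ n ≤ t)
    × (Admits n 1 t ⇔ (t ≤ n × n ≤ 2 * t + 1))
    × (Admits n 2 t ⇔ (2 * t ≤ n × n ≤ 2 * t + 2))
    × (Admits n 3 t ⇔ (t ≡ 1 × (n ≡ 3 ⊎ n ≡ 4 ⊎ n ≡ 5)))
    × ((κ : ℕ) → 4 ≤ κ →
        (κ % 2 ≡ 1 → (Admits n κ t ⇔ ((suc κ * t ∸ 1 ≤ n) × (n ≤ (2 * κ ∸ 4) * t + κ))))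
        × (κ % 2 ≡ 0 → (Admits n κ t ⇔ ((κ * t ≤ n) × (n ≤ (2 * κ ∸ 4) * t + κ)))))
lemma7 n 1≤n (suc c) 1≤t =
  via (runs-0 n t) , via (runs-1 n t 1≤n) , via (runs-2 n t 1≤t) , via (mk⇔ (runs-3-bounds 1≤t) runs-3-intro) ,
  λ κ 4≤κ → let (odd , even) = runs-many n c κ 4≤κ in (λ p → via (odd p)) , (λ p → via (even p))
  where
  t = suc c
  via : ∀ {κ} {P : Set} → AdmitsRuns n κ t ⇔ P → Admits n κ t ⇔ P
  via = _⇔-∘ admits⇔admitsRuns 1≤t
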